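{- Let $\alpha$ be a snowy weak composition. Let $n$ be the smallest positive integer such that $\mathsf{supp}(\alpha) \subseteq [n]$ and let $m = \max(\alpha)$. Let $w = \mathsf{std}_{m,n}(\alpha)$. Then the set $\mathsf{LTBPD}(\alpha)$ of left-to-top bumpless pipedreams of $\alpha$ is exactly the set obtained by taking each bumpless pipedream in $\mathsf{BPD}(w)$, restricting it to its first $n$ rows and first $m$ columns, and rotating this $n \times m$ region by $180^\circ$.
   Context: A weak composition $\alpha=(\alpha_1,\alpha_2,\dots)$ is a sequence of non-negative integers with finitely many positive entries; $\mathsf{supp}(\alpha)=\{i:\alpha_i>0\}$; it is snowy if its positive entries are distinct. For positive integers $m,n$ and $\alpha$ with $\mathsf{supp}(\alpha)\subseteq[n]$ and all $\alpha_i\le m$, the reverse complement is $r_{m,n}(\alpha)=(m-\alpha_n,\dots,m-\alpha_1)$. For snowy $\alpha$ with $\mathsf{supp}(\alpha)\subseteq[n]$ and $m\ge\max(\alpha)$, the $(m,n)$-standardization $\mathsf{std}_{m,n}(\alpha)$ is the unique permutation $w$ of $\{1,2,\dots\}$ (permuting finitely many elements) with $w(n+1)<w(n+2)<\cdots$ and, for $i\in[n]$, $w(i)=r_{m+1,n}(\alpha)_i$ if $r_{m+1,n}(\alpha)_i\le m$, and $w(i)=m+|\{j\in[i]: r_{m+1,n}(\alpha)_j=m+1\}|$ if $r_{m+1,n}(\alpha)_i=m+1$. For a permutation $w\in S_N$, a (reduced) bumpless pipedream of $w$ is an $N\times N$ grid (row 1 on top, column 1 on the left) tiled by the six tiles: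 blank, an elbow turning from bottom to right, an elbow turning from left to top, a crossing, a horizontal segment, and a vertical segment, such that for each $i\in[N]$ a pipe enters from the bottom of column $i$ and exits at the right edge of row $w(i)$, and no two pipes cross more than once; $\mathsf{BPD}(w)$ denotes the set of these. For snowy $\alpha$ with $n$ smallest such that $\mathsf{supp}(\alpha)\subseteq[n]$ and $m=\max(\alpha)$, a left-to-top bumpless pipedream of $\alpha$ is an $n$-row, $m$-column grid tiled by the same six tiles such that for each $i\in[n]$ with $\alpha_i>0$ a pipe enters from the left of row $i$ and exits at the top of column $\alpha_i$, and no two pipes cross more than once; $\mathsf{LTBPD}(\alpha)$ denotes the set of these. -}

module Defs where

open import Data.Nat using (ℕ; zero; suc; _+_; _∸_; _≤_; _<_; _⊔_; _<ᵇ_; _≡ᵇ_)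
open import Data.Bool using (Bool; true; false; _∧_; _∨_; if_then_else_)
open import Data.Fin using (Fin; toℕ; opposite; inject≤)
open import Data.Maybe using (Maybe; just; nothing)
open import Data.List using (List; []; _∷_)
open import Data.Product using (Σ; _×_; _,_; proj₁; proj₂; ∃-syntax)
open import Relation.Binary.PropositionalEquality using (_≡_; _≢_)

-- A weak composition α = (α₁, α₂, …) is modelled as a function α : ℕ → ℕ,
-- 1-indexed: α i is the i-th entry for i ≥ 1; the value α 0 is never used.
-- Finiteness of the support is provided by the hypothesis on n below.

SuppWithin : (ℕ → ℕ) → ℕ → Set
SuppWithin α k = ∀ i → k < i → α i ≡ 0

IsLeastSuppBound : (ℕ → ℕ) → ℕ → Set
IsLeastSuppBound α n =
  (1 ≤ n) × SuppWithin α n × (∀ k → 1 ≤ k → SuppWithin α k → n ≤ k)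

Snowy : (ℕ → ℕ) → Set
Snowy α = ∀ i j → 1 ≤ i → 1 ≤ j → i ≢ j → 0 < α i → α i ≢ α j

-- maxTo α n = max(α₁, …, αₙ) (= max(α) when supp(α) ⊆ [n]); maxTo α 0 = 0
maxTo : (ℕ → ℕ) → ℕ → ℕ
maxTo α zero    = 0
maxTo α (suc k) = α (suc k) ⊔ maxTo α k

revComp : ℕ → ℕ → (ℕ → ℕ) → ℕ → ℕ
revComp m n α i = m ∸ α (suc n ∸ i)

countTo : (ℕ → Bool) → ℕ → ℕ
countTo p zero    = 0
countTo p (suc i) = (if p (suc i) then 1 else 0) + countTo p i

stdHead : ℕ → ℕ → (ℕ → ℕ) → ℕ → ℕ
stdHead m n α i =
  if r i ≡ᵇ suc m
    then m + countTo (λ j → r j ≡ᵇ suc m) i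
    else r i
  where
  r : ℕ → ℕ
  r = revComp (suc m) n α

-- w : ℕ → ℕ is a permutation of {1,2,…} moving finitely many elements
-- (the value w 0 is irrelevant and unconstrained)
record IsFinPerm (w : ℕ → ℕ) : Set where
  field
    positive  : ∀ i → 1 ≤ i → 1 ≤ w i
    injective : ∀ i j → 1 ≤ i → 1 ≤ j → w i ≡ w j → i ≡ j
    surjective : ∀ k → 1 ≤ k → ∃[ i ] (1 ≤ i × w i ≡ k)
    finiteSupport : ∃[ B ] (∀ i → B < i → w i ≡ i)

-- w = std_{m,n}(α): the unique such permutation with w(n+1) < w(n+2) < ⋯
-- and w(i) given by stdHead for i ∈ [n]
record IsStd (m n : ℕ) (α : ℕ → ℕ) (w : ℕ → ℕ) : Set where
  field
    perm : IsFinPerm w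
    increasingTail : ∀ i j → n < i → i < j → w i < w j
    head : ∀ i → 1 ≤ i → i ≤ n → w i ≡ stdHead m n α i

data Tile : Set where
  blank   : Tile
  rElbow  : Tile   -- elbow joining the bottom edge to the right edge  (┌)
  jElbow  : Tile   -- elbow joining the left edge to the top edge      (┘)
  cross   : Tile
  hline   : Tile
  vline   : Tile

topE bottomE leftE rightE : Tile → Bool
topE jElbow = true
topE cross  = true
topE vline  = true
topE _      = false
bottomE rElbow = true
bottomE cross  = true
bottomE vline  = true
bottomE _      = false
leftE jElbow = true
leftE cross  = true
leftE hline  = true
leftE _      = false
rightE rElbow = true
rightE cross  = true
rightE hline  = true
rightE _      = false

rot180 : Tile → Tile
rot180 rElbow = jElbow
rot180 jElbow = rElbow
rot180 t      = t

-- an R-row, C-column grid; row index 0 is the top row, column index 0 the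
-- leftmost column (0-indexed Fin coordinates)
Grid : ℕ → ℕ → Set
Grid R C = Fin R → Fin C → Tile

record WellTiled {R C : ℕ} (G : Grid R C) : Set where
  field
    horizontal : ∀ (i : Fin R) (j j′ : Fin C) → suc (toℕ j) ≡ toℕ j′ →
                 rightE (G i j) ≡ leftE (G i j′)
    vertical   : ∀ (i i′ : Fin R) (j : Fin C) → suc (toℕ i) ≡ toℕ i′ →
                 bottomE (G i j) ≡ topE (G i′ j)

-- Following pipes.  Pipes only travel upwards or rightwards.

data Dir : Set where
  up rightward : Dir

-- entering a tile while travelling in direction d, the direction of travel
-- when leaving it (nothing: the tile has no pipe entering that way)
transit : Tile → Dir → Maybe Dir
transit rElbow up        = just rightward
transit cross  up        = just up
transit vline  up        = just up
transit jElbow rightward = just up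
transit cross  rightward = just rightward
transit hline  rightward = just rightward
transit _      _         = nothing

toFin : (R : ℕ) → ℕ → Maybe (Fin R)
toFin zero    _       = nothing
toFin (suc R) zero    = just Fin.zero
toFin (suc R) (suc i) with toFin R i
... | just k  = just (Fin.suc k)
... | nothing = nothing

tileAt : {R C : ℕ} → Grid R C → ℕ → ℕ → Maybe Tile
tileAt {R} {C} G i j with toFin R i | toFin C j
... | just a | just b = just (G a b)
... | _      | _      = nothing

data Outcome : Set where
  exitTop   : ℕ → Outcome   -- leaves through the top edge of this column (0-indexed)
  exitRight : ℕ → Outcome   -- leaves through the right edge of this row (0-indexed)
  stuck     : Outcome

Path : Set
Path = List (ℕ × ℕ) × Outcome

consP : ℕ × ℕ → Path → Path
consP p (ps , o) = (p ∷ ps , o)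

trace : {R C : ℕ} → ℕ → Grid R C → ℕ → ℕ → Dir → Path
trace zero    G i j d = ([] , stuck)
trace {R} {C} (suc f) G i j d = go (tileAt G i j)
  where
  goUp : ℕ → Path
  goUp zero     = ([] , exitTop j)
  goUp (suc i′) = trace f G i′ j up
  next : Maybe Dir → Path
  next nothing          = ([] , stuck)
  next (just up)        = consP (i , j) (goUp i)
  next (just rightward) =
    if suc j <ᵇ C
      then consP (i , j) (trace f G i (suc j) rightward)
      else consP (i , j) ([] , exitRight i)
  go : Maybe Tile → Path
  go nothing  = ([] , stuck)
  go (just t) = next (transit t d)

-- the pipe entering from the bottom of column c (1-indexed) of an N × N grid
pipeFromBottom : {N : ℕ} → Grid N N → ℕ → Path
pipeFromBottom {N} G c = trace (N + N) G (N ∸ 1) (c ∸ 1) up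

-- the pipe entering from the left of row r (1-indexed) of an R × C grid
pipeFromLeft : {R C : ℕ} → Grid R C → ℕ → Path
pipeFromLeft {R} {C} G r = trace (R + C) G (r ∸ 1) 0 rightward

memberᵇ : ℕ × ℕ → List (ℕ × ℕ) → Bool
memberᵇ p [] = false
memberᵇ (a , b) ((c , d) ∷ ps) = ((a ≡ᵇ c) ∧ (b ≡ᵇ d)) ∨ memberᵇ (a , b) ps

isCrossAt : {R C : ℕ} → Grid R C → ℕ × ℕ → Bool
isCrossAt G (i , j) with tileAt G i j
... | just cross = true
... | _          = false

-- number of crossing tiles through which both paths pass
-- (= number of times the two pipes cross)
crossings : {R C : ℕ} → Grid R C → Path → Path → ℕ
crossings G (ps , _) (qs , _) = go ps
  where
  go : List (ℕ × ℕ) → ℕ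
  go [] = 0
  go (p ∷ rest) = (if isCrossAt G p ∧ memberᵇ p qs then 1 else 0) + go rest

-- Convention (standard, Lam–Lee–Shimozono): the pipe exiting at the right
-- edge of row i enters from the bottom of column w(i).

record IsBPD (N : ℕ) (w : ℕ → ℕ) (G : Grid N N) : Set where
  field
    wellTiled   : WellTiled G
    leftEmpty   : ∀ i j → toℕ j ≡ 0 → leftE (G i j) ≡ false
    topEmpty    : ∀ i j → toℕ i ≡ 0 → topE (G i j) ≡ false
    bottomFull  : ∀ i j → suc (toℕ i) ≡ N → bottomE (G i j) ≡ true
    rightFull   : ∀ i j → suc (toℕ j) ≡ N → rightE (G i j) ≡ true
    pipes       : ∀ i → 1 ≤ i → i ≤ N →
                  proj₂ (pipeFromBottom G (w i)) ≡ exitRight (i ∸ 1)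
    reduced     : ∀ a b → 1 ≤ a → a ≤ N → 1 ≤ b → b ≤ N → a ≢ b →
                  crossings G (pipeFromBottom G a) (pipeFromBottom G b) ≤ 1

record IsLTBPD (α : ℕ → ℕ) (n m : ℕ) (G : Grid n m) : Set where
  field
    wellTiled   : WellTiled G
    leftBoundary : ∀ i j → toℕ j ≡ 0 → leftE (G i j) ≡ (0 <ᵇ α (suc (toℕ i)))
    topBoundary : ∀ i j → toℕ i ≡ 0 → topE (G i j) ≡ true →
                  ∃[ k ] (1 ≤ k × k ≤ n × α k ≡ suc (toℕ j))
    bottomEmpty : ∀ i j → suc (toℕ i) ≡ n → bottomE (G i j) ≡ false
    rightEmpty  : ∀ i j → suc (toℕ j) ≡ m → rightE (G i j) ≡ false
    pipes       : ∀ k → 1 ≤ k → k ≤ n → 0 < α k →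
                  proj₂ (pipeFromLeft G k) ≡ exitTop (α k ∸ 1)
    reduced     : ∀ a b → 1 ≤ a → a ≤ n → 1 ≤ b → b ≤ n → a ≢ b →
                  0 < α a → 0 < α b →
                  crossings G (pipeFromLeft G a) (pipeFromLeft G b) ≤ 1

restrictRotate : {n m N : ℕ} → n ≤ N → m ≤ N → Grid N N → Grid n m
restrictRotate n≤N m≤N B i j =
  rot180 (B (inject≤ (opposite i) n≤N) (inject≤ (opposite j) m≤N))

-- Given T, glue its 180° rotation into the region, the top-left n × m corner of an N × N grid,
-- and fill the rest with the Rothe bumpless pipedream of w.  For k ≤ n with α (n + 1 - k) > 0 the
-- value w k = m + 1 - α (n + 1 - k) is at most m, so the pipe of w k rises to row n, runs through
-- the region as the rotated pipe of T entering row n + 1 - k and leaves it in row k; every other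
-- pipe is a Rothe hook turning outside the region.  Hooks and region pipes meet at most once by
-- their shapes, and two region pipes cross only inside the region, as two pipes of T do.
-- Conversely, in any bumpless pipedream B of w the tiles outside the region are forced to be the
-- Rothe tiles, row by row from the bottom (w increases after position n) and then column by column
-- from the right (the values of w above m on [n] are m + 1, m + 2, … in order), so the pipes of B
-- restricted to the region are, rotated, the pipes of a left-to-top pipedream of α.

module Submission where

open import Defs
open import Data.Bool using (Bool; true; false; _∧_; _∨_; if_then_else_)
open import Data.Bool.Properties using (T-≡; ⇔→≡; ∧-zeroʳ; ∨-zeroʳ; ∨-identityʳ; ∧-conicalˡ; ∧-conicalʳ)
open import Data.Empty using (⊥; ⊥-elim)
open import Data.Fin using (Fin; toℕ; fromℕ<; opposite; inject≤)
open import Data.Fin.Properties using (toℕ-fromℕ<; fromℕ<-toℕ; toℕ<n; toℕ-inject≤; opposite-prop)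
open import Data.List using (List; []; _∷_; _++_; length; reverse; map; [_])
open import Data.List.Properties using (unfold-reverse)
open import Data.List.Membership.Propositional using (_∈_)
open import Data.List.Relation.Unary.All as All using (All; []; _∷_)
open import Data.List.Relation.Unary.Any as Any using (Any; here; there)
open import Data.List.Relation.Unary.AllPairs using ([]; _∷_)
open import Data.List.Relation.Unary.Unique.Propositional using (Unique)
open import Data.List.Relation.Unary.Any.Properties using (++⁻; ++⁺ˡ; ++⁺ʳ; reverse⁺; reverse⁻; map⁺; map⁻)
open import Data.Maybe using (Maybe; just; nothing)
import Data.Maybe as Maybe
open import Data.Nat
open import Data.Nat.Properties
open import Data.Product using (Σ; _×_; _,_; proj₁; proj₂; map₂)
open import Data.Sum using (_⊎_; inj₁; inj₂; [_,_]′)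
open import Data.Unit using (⊤; tt)
open import Function.Bundles using (_⇔_; mk⇔; Equivalence)
open import Relation.Binary.Definitions using (tri<; tri≈; tri>)
open import Relation.Binary.PropositionalEquality hiding ([_])
open import Relation.Nullary using (¬_; yes; no)
open import Relation.Nullary.Decidable using (dec-true; dec-false)

true≢false : true ≢ false
true≢false ()

∧-intro : ∀ {a b} → a ≡ true → b ≡ true → a ∧ b ≡ true
∧-intro refl refl = refl

<ᵇ-true : ∀ {m n} → m < n → (m <ᵇ n) ≡ true
<ᵇ-true {m} {n} = dec-true (m <? n)

<ᵇ-false : ∀ {m n} → m ≮ n → (m <ᵇ n) ≡ false
<ᵇ-false {m} {n} = dec-false (m <? n)

<ᵇ-sound : ∀ {m n} → (m <ᵇ n) ≡ true → m < n
<ᵇ-sound {m} {n} eq = <ᵇ⇒< m n (Equivalence.from T-≡ eq)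

<ᵇ-complete : ∀ {m n} → (m <ᵇ n) ≡ false → m ≮ n
<ᵇ-complete eq m<n = true≢false (trans (sym (<ᵇ-true m<n)) eq)

≡ᵇ-true : ∀ {m n} → m ≡ n → (m ≡ᵇ n) ≡ true
≡ᵇ-true {m} {n} = dec-true (m ≟ n)

≡ᵇ-false : ∀ {m n} → m ≢ n → (m ≡ᵇ n) ≡ false
≡ᵇ-false {m} {n} = dec-false (m ≟ n)

≡ᵇ-sound : ∀ {m n} → (m ≡ᵇ n) ≡ true → m ≡ n
≡ᵇ-sound {m} {n} eq = ≡ᵇ⇒≡ m n (Equivalence.from T-≡ eq)

suc[n∸1]≡n : ∀ {n} → 1 ≤ n → suc (n ∸ 1) ≡ n
suc[n∸1]≡n {suc n} _ = refl

n∸1<n : ∀ {n} → 1 ≤ n → n ∸ 1 < n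
n∸1<n 1≤n = ≤-reflexive (suc[n∸1]≡n 1≤n)

≢-pred : ∀ {a b} → 1 ≤ a → 1 ≤ b → a ≢ b → a ∸ 1 ≢ b ∸ 1
≢-pred {suc a} {suc b} _ _ a≢b eq = a≢b (cong suc eq)

m∸n≡suc[m∸1+n] : ∀ {m n} → n < m → m ∸ n ≡ suc (m ∸ suc n)
m∸n≡suc[m∸1+n] {suc m} (s≤s n≤m) = +-∸-assoc 1 n≤m

mirror-< : ∀ {R i} → i < R → R ∸ suc i < R
mirror-< i<R = ∸-monoʳ-< z<s i<R

mirror-involutive : ∀ {R i} → i < R → R ∸ suc (R ∸ suc i) ≡ i
mirror-involutive {suc R} (s≤s i≤R) = m∸[m∸n]≡n i≤R

mirror-injective : ∀ {R i i′} → i < R → i′ < R → R ∸ suc i ≡ R ∸ suc i′ → i ≡ i′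
mirror-injective {R} i<R i′<R eq =
  trans (sym (mirror-involutive i<R)) (trans (cong (λ x → R ∸ suc x) eq) (mirror-involutive i′<R))

[m∸1+n]+n≡m∸1 : ∀ {i M} → i < M → (M ∸ suc i) + i ≡ M ∸ 1
[m∸1+n]+n≡m∸1 {i} {suc M} (s≤s i≤M) = m∸n+n≡m i≤M

suc[m]∸n≤m : ∀ m {x} → 0 < x → suc m ∸ x ≤ m
suc[m]∸n≤m m {suc x} _ = m∸n≤m m x

∸-flip : ∀ {m x j} → 0 < x → x ≤ m → suc j ≡ suc m ∸ x → x ∸ 1 ≡ m ∸ suc j
∸-flip {m} {suc x} _ x<m eq = sym (trans (cong (m ∸_) eq) (m∸[m∸n]≡n (≤-trans (n≤1+n x) x<m)))

n∸[1+n∸k]≡k∸1 : ∀ {n k} → 1 ≤ k → k ≤ n → n ∸ (suc n ∸ k) ≡ k ∸ 1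
n∸[1+n∸k]≡k∸1 {k = suc k} _ k+1≤n = m∸[m∸n]≡n (≤-trans (n≤1+n k) k+1≤n)

last-index : ∀ {x y} → suc y ≮ x → y < x → x ∸ suc y ≡ 0
last-index {x} {y} y+1≮x y<x with refl ← ≤-antisym y<x (≮⇒≥ y+1≮x) = n∸n≡0 (suc y)

downward-induction : ∀ (P : ℕ → Set) lo N → (∀ i → lo ≤ i → i < N → (∀ r → i < r → r < N → P r) → P i) →
                     ∀ i → lo ≤ i → i < N → P i
downward-induction P lo N step i = go (N ∸ i) i ≤-refl
  where
  go : ∀ d i → N ∸ i ≤ d → lo ≤ i → i < N → P i
  go zero    i N∸i≤0 _    i<N = ⊥-elim (<⇒≱ i<N (m∸n≡0⇒m≤n (n≤0⇒n≡0 N∸i≤0)))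
  go (suc d) i N∸i≤d lo≤i i<N = step i lo≤i i<N λ r i<r r<N →
    go d r (≤-pred (≤-trans (∸-monoʳ-< i<r (<⇒≤ r<N)) N∸i≤d)) (≤-trans lo≤i (<⇒≤ i<r)) r<N

-- Tiles

transit-rot180 : ∀ t d {d′} → transit t d ≡ just d′ → transit (rot180 t) d′ ≡ just d
transit-rot180 rElbow up        refl = refl
transit-rot180 jElbow rightward refl = refl
transit-rot180 cross  up        refl = refl
transit-rot180 cross  rightward refl = refl
transit-rot180 hline  rightward refl = refl
transit-rot180 vline  up        refl = refl

rot180-involutive : ∀ t → rot180 (rot180 t) ≡ t
rot180-involutive blank  = refl
rot180-involutive rElbow = refl
rot180-involutive jElbow = refl
rot180-involutive cross  = refl
rot180-involutive hline  = refl
rot180-involutive vline  = refl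

isCross : Tile → Bool
isCross cross = true
isCross _     = false

transit⇒topE : ∀ t d → transit t d ≡ just up → topE t ≡ true
transit⇒topE jElbow rightward _ = refl
transit⇒topE cross  up        _ = refl
transit⇒topE vline  up        _ = refl
transit⇒topE blank  up        ()
transit⇒topE blank  rightward ()
transit⇒topE rElbow up        ()
transit⇒topE rElbow rightward ()
transit⇒topE jElbow up        ()
transit⇒topE cross  rightward ()
transit⇒topE hline  up        ()
transit⇒topE hline  rightward ()
transit⇒topE vline  rightward ()

isCross-rot180 : ∀ t → isCross (rot180 t) ≡ isCross t
isCross-rot180 rElbow = refl
isCross-rot180 jElbow = refl
isCross-rot180 blank  = refl
isCross-rot180 cross  = refl
isCross-rot180 hline  = refl
isCross-rot180 vline  = refl

rightE-rot180 : ∀ t → rightE (rot180 t) ≡ leftE t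
rightE-rot180 rElbow = refl
rightE-rot180 jElbow = refl
rightE-rot180 blank  = refl
rightE-rot180 cross  = refl
rightE-rot180 hline  = refl
rightE-rot180 vline  = refl

leftE-rot180 : ∀ t → leftE (rot180 t) ≡ rightE t
leftE-rot180 rElbow = refl
leftE-rot180 jElbow = refl
leftE-rot180 blank  = refl
leftE-rot180 cross  = refl
leftE-rot180 hline  = refl
leftE-rot180 vline  = refl

topE-rot180 : ∀ t → topE (rot180 t) ≡ bottomE t
topE-rot180 rElbow = refl
topE-rot180 jElbow = refl
topE-rot180 blank  = refl
topE-rot180 cross  = refl
topE-rot180 hline  = refl
topE-rot180 vline  = refl

bottomE-rot180 : ∀ t → bottomE (rot180 t) ≡ topE t
bottomE-rot180 rElbow = refl
bottomE-rot180 jElbow = refl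
bottomE-rot180 blank  = refl
bottomE-rot180 cross  = refl
bottomE-rot180 hline  = refl
bottomE-rot180 vline  = refl

transit-up-rightward : ∀ t → transit t up ≡ just rightward → t ≡ rElbow
transit-up-rightward rElbow _ = refl

transit-up-up : ∀ t → transit t up ≡ just up → t ≡ cross ⊎ t ≡ vline
transit-up-up cross _ = inj₁ refl
transit-up-up vline _ = inj₂ refl

transit-rightward-rightward : ∀ t → transit t rightward ≡ just rightward → t ≡ cross ⊎ t ≡ hline
transit-rightward-rightward cross _ = inj₁ refl
transit-rightward-rightward hline _ = inj₂ refl

¬leftE∧bottomE : ∀ t → leftE t ≡ false → bottomE t ≡ true → t ≡ rElbow ⊎ t ≡ vline
¬leftE∧bottomE rElbow _ _ = inj₁ refl
¬leftE∧bottomE vline  _ _ = inj₂ refl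

leftE∧bottomE : ∀ t → leftE t ≡ true → bottomE t ≡ true → t ≡ cross
leftE∧bottomE cross _ _ = refl

rightE∧¬bottomE : ∀ t → rightE t ≡ true → bottomE t ≡ false → t ≡ hline
rightE∧¬bottomE hline _ _ = refl

-- Boards and walks

Pos : Set
Pos = ℕ × ℕ

-- Grids are read as boards indexed by ℕ (blank outside), so that index arithmetic stays in ℕ.
Board : Set
Board = ℕ → ℕ → Tile

toFin-< : ∀ R i (i<R : i < R) → toFin R i ≡ just (fromℕ< i<R)
toFin-< (suc R) zero    _         = refl
toFin-< (suc R) (suc i) (s≤s i<R) rewrite toFin-< R i i<R = refl

toFin-≮ : ∀ R i → i ≮ R → toFin R i ≡ nothing
toFin-≮ zero    i       _   = refl
toFin-≮ (suc R) zero    i≮R = ⊥-elim (i≮R z<s)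
toFin-≮ (suc R) (suc i) i≮R rewrite toFin-≮ R i (λ i<R → i≮R (s≤s i<R)) = refl

board : ∀ {R C} → Grid R C → Board
board G i j with tileAt G i j
... | just t  = t
... | nothing = blank

board-tileAt : ∀ {R C} (G : Grid R C) i j {t} → tileAt G i j ≡ just t → board G i j ≡ t
board-tileAt G i j eq with tileAt G i j
board-tileAt G i j refl | just t = refl

board-inside : ∀ {R C} (G : Grid R C) i j (i<R : i < R) (j<C : j < C) →
               board G i j ≡ G (fromℕ< i<R) (fromℕ< j<C)
board-inside {R} {C} G i j i<R j<C = board-tileAt G i j tileAt≡
  where
  tileAt≡ : tileAt G i j ≡ just (G (fromℕ< i<R) (fromℕ< j<C))
  tileAt≡ rewrite toFin-< R i i<R | toFin-< C j j<C = refl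

board-toℕ : ∀ {R C} (G : Grid R C) (a : Fin R) (b : Fin C) → board G (toℕ a) (toℕ b) ≡ G a b
board-toℕ G a b = trans (board-inside G (toℕ a) (toℕ b) (toℕ<n a) (toℕ<n b))
                        (cong₂ G (fromℕ<-toℕ a _) (fromℕ<-toℕ b _))

board-outside-column : ∀ {R C} (G : Grid R C) i j → j ≮ C → board G i j ≡ blank
board-outside-column {R} {C} G i j j≮C = board-nothing tileAt≡
  where
  tileAt≡ : tileAt G i j ≡ nothing
  tileAt≡ with toFin R i | toFin C j | toFin-≮ C j j≮C
  ... | just _  | _ | refl = refl
  ... | nothing | _ | refl = refl
  board-nothing : tileAt G i j ≡ nothing → board G i j ≡ blank
  board-nothing eq with tileAt G i j
  board-nothing refl | nothing = refl

board-horizontal : ∀ {R C} {G : Grid R C} → WellTiled G → ∀ i j → i < R → suc j < C →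
                   rightE (board G i j) ≡ leftE (board G i (suc j))
board-horizontal {G = G} tiled i j i<R j+1<C
  rewrite board-inside G i j i<R (<-trans (n<1+n j) j+1<C) | board-inside G i (suc j) i<R j+1<C =
  WellTiled.horizontal tiled (fromℕ< i<R) (fromℕ< (<-trans (n<1+n j) j+1<C)) (fromℕ< j+1<C)
    (trans (cong suc (toℕ-fromℕ< (<-trans (n<1+n j) j+1<C))) (sym (toℕ-fromℕ< j+1<C)))

board-vertical : ∀ {R C} {G : Grid R C} → WellTiled G → ∀ i j → suc i < R → j < C →
                 bottomE (board G i j) ≡ topE (board G (suc i) j)
board-vertical {G = G} tiled i j i+1<R j<C
  rewrite board-inside G i j (<-trans (n<1+n i) i+1<R) j<C | board-inside G (suc i) j i+1<R j<C =
  WellTiled.vertical tiled (fromℕ< (<-trans (n<1+n i) i+1<R)) (fromℕ< i+1<R) (fromℕ< j<C)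
    (trans (cong suc (toℕ-fromℕ< (<-trans (n<1+n i) i+1<R))) (sym (toℕ-fromℕ< i+1<R)))

wellTiled-from-board : ∀ {R C} (G : Grid R C) →
                       (∀ i j → i < R → suc j < C → rightE (board G i j) ≡ leftE (board G i (suc j))) →
                       (∀ i j → suc i < R → j < C → bottomE (board G i j) ≡ topE (board G (suc i) j)) →
                       WellTiled G
wellTiled-from-board G horizontal vertical = record
  { horizontal = λ a b b′ b+1≡b′ → begin
      rightE (G a b)
        ≡⟨ cong rightE (sym (board-toℕ G a b)) ⟩
      rightE (board G (toℕ a) (toℕ b))
        ≡⟨ horizontal (toℕ a) (toℕ b) (toℕ<n a) (subst (_< _) (sym b+1≡b′) (toℕ<n b′)) ⟩
      leftE (board G (toℕ a) (suc (toℕ b)))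
        ≡⟨ cong (λ x → leftE (board G (toℕ a) x)) b+1≡b′ ⟩
      leftE (board G (toℕ a) (toℕ b′))
        ≡⟨ cong leftE (board-toℕ G a b′) ⟩
      leftE (G a b′) ∎
  ; vertical = λ a a′ b a+1≡a′ → begin
      bottomE (G a b)
        ≡⟨ cong bottomE (sym (board-toℕ G a b)) ⟩
      bottomE (board G (toℕ a) (toℕ b))
        ≡⟨ vertical (toℕ a) (toℕ b) (subst (_< _) (sym a+1≡a′) (toℕ<n a′)) (toℕ<n b) ⟩
      topE (board G (suc (toℕ a)) (toℕ b))
        ≡⟨ cong (λ x → topE (board G x (toℕ b))) a+1≡a′ ⟩
      topE (board G (toℕ a′) (toℕ b))
        ≡⟨ cong topE (board-toℕ G a′ b) ⟩
      topE (G a′ b) ∎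
  }
  where open ≡-Reasoning

-- A relational, fuel-free counterpart of Defs.trace: Walk g C s e ps follows the pipe of the
-- board g of width C from state s to state e through the tiles ps, where a state is a tile about
-- to be entered in some direction, or an exit through the top of a column or the right of a row.
data State : Set where
  at       : ℕ → ℕ → Dir → State
  outTop   : ℕ → State
  outRight : ℕ → State

data Exit : State → Set where
  top   : ∀ j → Exit (outTop j)
  right : ∀ i → Exit (outRight i)

outcome : State → Outcome
outcome (at _ _ _)   = stuck
outcome (outTop j)   = exitTop j
outcome (outRight i) = exitRight i

stepUp : ℕ → ℕ → State
stepUp zero    j = outTop j
stepUp (suc i) j = at i j up

leave : ℕ → ℕ → ℕ → Dir → State
leave C i j up        = stepUp i j
leave C i j rightward = if suc j <ᵇ C then at i (suc j) rightward else outRight i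

leave-rightward-inside : ∀ C i j → suc j < C → leave C i j rightward ≡ at i (suc j) rightward
leave-rightward-inside C i j p rewrite <ᵇ-true p = refl

leave-rightward-edge : ∀ C i j → suc j ≮ C → leave C i j rightward ≡ outRight i
leave-rightward-edge C i j p rewrite <ᵇ-false p = refl

step : Board → ℕ → ℕ → ℕ → Dir → Maybe State
step g C i j d = Maybe.map (leave C i j) (transit (g i j) d)

step-transit : ∀ g C i j d {d′} → transit (g i j) d ≡ just d′ → step g C i j d ≡ just (leave C i j d′)
step-transit g C i j d eq rewrite eq = refl

step-inverse : ∀ g C i j d {s} → step g C i j d ≡ just s →
               Σ Dir λ d′ → transit (g i j) d ≡ just d′ × s ≡ leave C i j d′
step-inverse g C i j d eq with transit (g i j) d
step-inverse g C i j d refl | just d′ = d′ , refl , refl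

step-cong : ∀ g g′ C i j d → g i j ≡ g′ i j → step g C i j d ≡ step g′ C i j d
step-cong g g′ C i j d eq = cong (λ t → Maybe.map (leave C i j) (transit t d)) eq

data Walk (g : Board) (C : ℕ) : State → State → List Pos → Set where
  done : ∀ {s} → Walk g C s s []
  more : ∀ {i j d s e ps} → step g C i j d ≡ just s → Walk g C s e ps →
         Walk g C (at i j d) e ((i , j) ∷ ps)

walk-++ : ∀ {g C s s′ e ps qs} → Walk g C s s′ ps → Walk g C s′ e qs → Walk g C s e (ps ++ qs)
walk-++ done       q = q
walk-++ (more x p) q = more x (walk-++ p q)

walk-from-exit : ∀ {g C s e ps} → Walk g C s e ps → Exit s → (e ≡ s) × (ps ≡ [])
walk-from-exit done _ = refl , refl

walk-split : ∀ {g C s s′ e ps′ ps} → Walk g C s s′ ps′ → Walk g C s e ps → Exit e →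
             Σ (List Pos) λ qs → Walk g C s′ e qs × ps ≡ ps′ ++ qs
walk-split done       q           _  = _ , q , refl
walk-split (more x p) (more x′ q) ex with trans (sym x) x′
... | refl with walk-split p q ex
...   | qs , q′ , refl = qs , q′ , refl

potential : ℕ → State → ℕ
potential C (at i j _)   = suc i + (C ∸ j)
potential C (outTop _)   = 0
potential C (outRight i) = i

potentialAt : ℕ → Pos → ℕ
potentialAt C (i , j) = suc i + (C ∸ j)

step-potential : ∀ g C i j d {s} → step g C i j d ≡ just s → potential C s < potentialAt C (i , j)
step-potential g C i j d st with step-inverse g C i j d st
... | up , _ , refl = up-decreases i
  where
  up-decreases : ∀ i → potential C (stepUp i j) < suc i + (C ∸ j)
  up-decreases zero    = z<s
  up-decreases (suc i) = ≤-refl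
... | rightward , _ , refl with suc j <ᵇ C in fits
...   | true  = +-monoʳ-< (suc i) (∸-monoʳ-< (n<1+n j) (<⇒≤ (<ᵇ-sound fits)))
...   | false = ≤-trans (n<1+n i) (m≤m+n (suc i) _)

walk-length : ∀ {g C s e ps} → Walk g C s e ps → length ps + potential C e ≤ potential C s
walk-length done = ≤-refl
walk-length {g} {C} (more {i} {j} {d} st rest) = ≤-trans (s≤s (walk-length rest)) (step-potential g C i j d st)

walk-potentials : ∀ {g C s e ps} → Walk g C s e ps → All (λ p → potentialAt C p ≤ potential C s) ps
walk-potentials done = []
walk-potentials {g} {C} (more {i} {j} {d} st rest) =
  ≤-refl ∷ All.map (λ le → ≤-trans le (<⇒≤ (step-potential g C i j d st))) (walk-potentials rest)

walk-unique : ∀ {g C s e ps} → Walk g C s e ps → Unique ps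
walk-unique done = []
walk-unique {g} {C} (more {i} {j} {d} st rest) =
  All.map (λ q≤ q≡ → <-irrefl (cong (potentialAt C) (sym q≡)) (≤-<-trans q≤ (step-potential g C i j d st)))
          (walk-potentials rest)
  ∷ walk-unique rest

row : State → ℕ
row (at i _ _)   = i
row (outTop _)   = 0
row (outRight i) = i

step-row : ∀ g C i j d {s} → step g C i j d ≡ just s → row s ≤ i
step-row g C i j d st with step-inverse g C i j d st
... | up , _ , refl = up-row i
  where
  up-row : ∀ i → row (stepUp i j) ≤ i
  up-row zero    = z≤n
  up-row (suc i) = n≤1+n i
... | rightward , _ , refl with suc j <ᵇ C
...   | true  = ≤-refl
...   | false = ≤-refl

walk-row : ∀ {g C s e ps} → Walk g C s e ps → row e ≤ row s
walk-row done = ≤-refl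
walk-row {g} {C} (more {i} {j} {d} st rest) = ≤-trans (walk-row rest) (step-row g C i j d st)

stepUp-exits-above : ∀ {g C i j x ps} → Walk g C (stepUp i j) (outRight x) ps → x < i
stepUp-exits-above {i = zero} {j} w with () , _ ← walk-from-exit w (top j)
stepUp-exits-above {i = suc i}    w = s≤s (walk-row w)

InBox : ℕ → ℕ → Pos → Set
InBox R C (i , j) = i < R × j < C

Inside : ℕ → ℕ → State → Set
Inside R C (at i j _)   = InBox R C (i , j)
Inside R C (outTop _)   = ⊤
Inside R C (outRight _) = ⊤

step-inside : ∀ g R C i j d {s} → step g C i j d ≡ just s → i < R → j < C → Inside R C s
step-inside g R C i j d st i<R j<C with step-inverse g C i j d st
... | up , _ , refl = up-inside i i<R
  where
  up-inside : ∀ i → i < R → Inside R C (stepUp i j)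
  up-inside zero    _   = tt
  up-inside (suc i) i<R = <-trans (n<1+n i) i<R , j<C
... | rightward , _ , refl with suc j <ᵇ C in fits
...   | true  = i<R , <ᵇ-sound fits
...   | false = tt

walk-inside : ∀ {g R C s e ps} → Walk g C s e ps → Inside R C s → All (InBox R C) ps
walk-inside done _ = []
walk-inside {g} {R} {C} (more {i} {j} {d} st rest) (i<R , j<C) =
  (i<R , j<C) ∷ walk-inside rest (step-inside g R C i j d st i<R j<C)

walk-cong : ∀ {g g′ R C s e ps} → (∀ i j → i < R → j < C → g i j ≡ g′ i j) →
            Walk g C s e ps → Inside R C s → Walk g′ C s e ps
walk-cong g≡g′ done _ = done
walk-cong {g} {g′} {R} {C} g≡g′ (more {i} {j} {d} st rest) (i<R , j<C) =
  more (trans (sym (step-cong g g′ C i j d (g≡g′ i j i<R j<C))) st)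
       (walk-cong g≡g′ rest (step-inside g R C i j d st i<R j<C))

data TraceView {R C} (G : Grid R C) (i j : ℕ) (d : Dir) : Path → Set where
  stuck′ : ∀ {ps} → TraceView G i j d (ps , stuck)
  walked : ∀ {ps e} → Exit e → Walk (board G) C (at i j d) e ps → TraceView G i j d (ps , outcome e)

view-cons : ∀ {R C} {G : Grid R C} {i j d i′ j′ d′ p} → step (board G) C i′ j′ d′ ≡ just (at i j d) →
            TraceView G i j d p → TraceView G i′ j′ d′ (consP (i′ , j′) p)
view-cons st stuck′        = stuck′
view-cons st (walked ex w) = walked ex (more st w)

view-outTop : ∀ {R C} {G : Grid R C} {i j d p x} → TraceView G i j d p → proj₂ p ≡ exitTop x →
              Walk (board G) C (at i j d) (outTop x) (proj₁ p)
view-outTop (walked (top _) w) refl = w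

view-outRight : ∀ {R C} {G : Grid R C} {i j d p x} → TraceView G i j d p → proj₂ p ≡ exitRight x →
                Walk (board G) C (at i j d) (outRight x) (proj₁ p)
view-outRight (walked (right _) w) refl = w

step-board : ∀ {R C} (G : Grid R C) i j d {t d′} → tileAt G i j ≡ just t → transit t d ≡ just d′ →
             step (board G) C i j d ≡ just (leave C i j d′)
step-board G i j d tile≡ transit≡ =
  step-transit (board G) _ i j d (trans (cong (λ t → transit t d) (board-tileAt G i j tile≡)) transit≡)

trace-view : ∀ {R C} (G : Grid R C) f i j d → TraceView G i j d (trace f G i j d)
trace-view G zero i j d = stuck′
trace-view G (suc f) i j d with tileAt G i j in tile≡
... | nothing = stuck′
... | just t with transit t d in transit≡
...   | nothing = stuck′
trace-view G (suc f) zero j d | just t | just up =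
  walked (top j) (more (step-board G zero j d tile≡ transit≡) done)
trace-view G (suc f) (suc i) j d | just t | just up =
  view-cons (step-board G (suc i) j d tile≡ transit≡) (trace-view G f i j up)
trace-view {C = C} G (suc f) i j d | just t | just rightward with suc j <ᵇ C in fits
... | true  = view-cons (trans (step-board G i j d tile≡ transit≡) (cong just (leave-rightward-inside C i j (<ᵇ-sound fits))))
                        (trace-view G f i (suc j) rightward)
... | false = walked (right i) (more (trans (step-board G i j d tile≡ transit≡)
                                             (cong just (leave-rightward-edge C i j (<ᵇ-complete fits)))) done)

nothing≢just : ∀ {A : Set} {x : A} → nothing ≢ just x
nothing≢just ()

trace-walk : ∀ {R C} (G : Grid R C) f i j d {e ps} → Walk (board G) C (at i j d) e ps → Exit e →
             length ps ≤ f → trace f G i j d ≡ (ps , outcome e)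
trace-walk G zero i j d (more _ _) _ ()
trace-walk G (suc f) i j d (more st rest) ex (s≤s len) with tileAt G i j
... | nothing = ⊥-elim (nothing≢just st)
... | just t with transit t d
...   | nothing = ⊥-elim (nothing≢just st)
trace-walk G (suc f) zero j d (more refl rest) ex (s≤s len) | just t | just up
  with refl , refl ← walk-from-exit rest (top j) = refl
trace-walk G (suc f) (suc i) j d (more refl rest) ex (s≤s len) | just t | just up =
  cong (consP (suc i , j)) (trace-walk G f i j up rest ex len)
trace-walk {C = C} G (suc f) i j d (more st rest) ex (s≤s len) | just t | just rightward with suc j <ᵇ C
trace-walk G (suc f) i j d (more refl rest) ex (s≤s len) | just t | just rightward | true =
  cong (consP (i , j)) (trace-walk G f i (suc j) rightward rest ex len)
trace-walk G (suc f) i j d (more refl rest) ex (s≤s len) | just t | just rightward | false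
  with refl , refl ← walk-from-exit rest (right i) = refl

rotate : ℕ → ℕ → Pos → Pos
rotate R C (i , j) = R ∸ suc i , C ∸ suc j

rotate-injective : ∀ R C p q → InBox R C p → InBox R C q → rotate R C p ≡ rotate R C q → p ≡ q
rotate-injective R C (i , j) (i′ , j′) (i<R , j<C) (i′<R , j′<C) eq =
  cong₂ _,_ (mirror-injective i<R i′<R (cong proj₁ eq)) (mirror-injective j<C j′<C (cong proj₂ eq))

-- Rotating an R × C board by 180° reverses every walk in it: entering tile (i , j) in direction d
-- corresponds to leaving the rotated tile in direction d.
module Rot180 (R C : ℕ) (g g′ : Board)
              (g′≡ : ∀ i j → i < R → j < C → g′ i j ≡ rot180 (g (R ∸ suc i) (C ∸ suc j))) where

  rotState : State → State
  rotState (at i j d)   = leave C (R ∸ suc i) (C ∸ suc j) d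
  rotState (outTop j)   = at (R ∸ 1) (C ∸ suc j) up
  rotState (outRight i) = at (R ∸ suc i) 0 rightward

  rotState-leave : ∀ i j d → i < R → j < C → rotState (leave C i j d) ≡ at (R ∸ suc i) (C ∸ suc j) d
  rotState-leave zero    j up i<R j<C = refl
  rotState-leave (suc i) j up i<R j<C rewrite m∸n≡suc[m∸1+n] i<R = refl
  rotState-leave i j rightward i<R j<C with suc j <? C
  ... | yes fits rewrite leave-rightward-inside C i j fits
                       | leave-rightward-inside C (R ∸ suc i) (C ∸ suc (suc j))
                           (subst (_< C) (m∸n≡suc[m∸1+n] fits) (mirror-< j<C))
    = cong (λ x → at (R ∸ suc i) x rightward) (sym (m∸n≡suc[m∸1+n] fits))
  ... | no edge rewrite leave-rightward-edge C i j edge with ≤-antisym j<C (≮⇒≥ edge)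
  ...   | refl rewrite n∸n≡0 (suc j) = refl

  step-reversed : ∀ i j d {s} → i < R → j < C → step g C i j d ≡ just s →
                  Walk g′ C (rotState s) (rotState (at i j d)) [ rotate R C (i , j) ]
  step-reversed i j d i<R j<C st with step-inverse g C i j d st
  ... | d′ , transit≡ , refl rewrite rotState-leave i j d′ i<R j<C =
    more (step-transit g′ C (R ∸ suc i) (C ∸ suc j) d′ rotated-transit) done
    where
    rotated-transit : transit (g′ (R ∸ suc i) (C ∸ suc j)) d′ ≡ just d
    rotated-transit = trans (cong (λ t → transit t d′)
                               (trans (g′≡ _ _ (mirror-< i<R) (mirror-< j<C))
                                      (cong₂ (λ a b → rot180 (g a b)) (mirror-involutive i<R) (mirror-involutive j<C))))
                            (transit-rot180 (g i j) d transit≡)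

  walk-reversed : ∀ {s e ps} → Walk g C s e ps → Inside R C s →
                  Walk g′ C (rotState e) (rotState s) (reverse (map (rotate R C) ps))
  walk-reversed done _ = done
  walk-reversed (more {i} {j} {d} {s} {e} {ps} st rest) (i<R , j<C) =
    subst (Walk g′ C (rotState e) (rotState (at i j d))) (sym (unfold-reverse (rotate R C (i , j)) (map (rotate R C) ps)))
      (walk-++ (walk-reversed rest (step-inside g R C i j d st i<R j<C)) (step-reversed i j d i<R j<C st))

-- A walk leaving the first m columns through their right edge enters column m of a wider board.
widen : ℕ → ℕ → State → State
widen m N (outRight i) = if m <ᵇ N then at i m rightward else outRight i
widen m N s            = s

module Widening (g : Board) (m N : ℕ) (m≤N : m ≤ N) where

  walk-widen : ∀ {i j d e ps} → Walk g m (at i j d) e ps → j < m → Exit e → Walk g N (at i j d) (widen m N e) ps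
  walk-widen (more {i} {j} {d} st rest) j<m ex with step-inverse g m i j d st
  walk-widen (more {zero} {j} {d} st rest) j<m ex | up , transit≡ , refl
    with refl , refl ← walk-from-exit rest (top j) = more (step-transit g N zero j d transit≡) done
  walk-widen (more {suc i} {j} {d} st rest) j<m ex | up , transit≡ , refl =
    more (step-transit g N (suc i) j d transit≡) (walk-widen rest j<m ex)
  walk-widen (more {i} {j} {d} st rest) j<m ex | rightward , transit≡ , s≡ with suc j <? m
  ... | yes fits rewrite leave-rightward-inside m i j fits | s≡ =
    more (trans (step-transit g N i j d transit≡) (cong just (leave-rightward-inside N i j (≤-trans fits m≤N))))
         (walk-widen rest fits ex)
  ... | no edge rewrite leave-rightward-edge m i j edge | s≡
    with refl , refl ← walk-from-exit rest (right i) | refl ← ≤-antisym j<m (≮⇒≥ edge) =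
    more (step-transit g N i j d transit≡) done

  walk-restrict : ∀ {i j d e ps} → Walk g N (at i j d) e ps → j < m → Exit e →
                  Σ State λ e′ → Σ (List Pos) λ ps₁ → Σ (List Pos) λ ps₂ →
                  Exit e′ × Walk g m (at i j d) e′ ps₁ × Walk g N (widen m N e′) e ps₂ × ps ≡ ps₁ ++ ps₂
  walk-restrict (more {i} {j} {d} st rest) j<m ex with step-inverse g N i j d st
  walk-restrict (more {zero} {j} {d} {e = e} {ps} st rest) j<m ex | up , transit≡ , refl =
    outTop j , [ (zero , j) ] , ps , top j , more (step-transit g m zero j d transit≡) done , rest , refl
  walk-restrict (more {suc i} {j} {d} st rest) j<m ex | up , transit≡ , refl
    with e′ , ps₁ , ps₂ , ex′ , w₁ , w₂ , refl ← walk-restrict rest j<m ex =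
    e′ , (suc i , j) ∷ ps₁ , ps₂ , ex′ , more (step-transit g m (suc i) j d transit≡) w₁ , w₂ , refl
  walk-restrict (more {i} {j} {d} {e = e} {ps} st rest) j<m ex | rightward , transit≡ , s≡ with suc j <? m
  ... | yes fits rewrite leave-rightward-inside N i j (≤-trans fits m≤N) | s≡
    with e′ , ps₁ , ps₂ , ex′ , w₁ , w₂ , refl ← walk-restrict rest fits ex =
    e′ , (i , j) ∷ ps₁ , ps₂ , ex′ ,
    more (trans (step-transit g m i j d transit≡) (cong just (leave-rightward-inside m i j fits))) w₁ , w₂ , refl
  ... | no edge with refl ← ≤-antisym j<m (≮⇒≥ edge) rewrite s≡ =
    outRight i , [ (i , j) ] , ps , right i ,
    more (trans (step-transit g m i j d transit≡) (cong just (leave-rightward-edge (suc j) i j edge))) done , rest , refl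

upPath : ℕ → ℕ → ℕ → List Pos
upPath j lo zero    = []
upPath j lo (suc k) = (suc k + lo , j) ∷ upPath j lo k

walk-up : ∀ g C j lo k → (∀ r → lo < r → r ≤ k + lo → transit (g r j) up ≡ just up) →
          Walk g C (at (k + lo) j up) (at lo j up) (upPath j lo k)
walk-up g C j lo zero    vertical = done
walk-up g C j lo (suc k) vertical =
  more (step-transit g C (suc k + lo) j up (vertical (suc k + lo) (s≤s (m≤n+m lo k)) ≤-refl))
       (walk-up g C j lo k (λ r lo<r r≤ → vertical r lo<r (≤-trans r≤ (n≤1+n _))))

∈-upPath : ∀ {p} j lo k → p ∈ upPath j lo k → proj₂ p ≡ j × lo < proj₁ p
∈-upPath j lo (suc k) (here refl) = refl , s≤s (m≤n+m lo k)
∈-upPath j lo (suc k) (there p∈)  = ∈-upPath j lo k p∈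

rightPath : ℕ → ℕ → ℕ → List Pos
rightPath i j zero    = []
rightPath i j (suc k) = (i , j) ∷ rightPath i (suc j) k

walk-right : ∀ g C i k j d → suc (k + j) ≡ C → transit (g i j) d ≡ just rightward →
             (∀ c → j < c → c < C → transit (g i c) rightward ≡ just rightward) →
             Walk g C (at i j d) (outRight i) (rightPath i j (suc k))
walk-right g C i zero    j d k+j≡ turn horizontal =
  more (trans (step-transit g C i j d turn) (cong just (leave-rightward-edge C i j (<-irrefl k+j≡)))) done
walk-right g C i (suc k) j d k+j≡ turn horizontal =
  more (trans (step-transit g C i j d turn) (cong just (leave-rightward-inside C i j fits)))
       (walk-right g C i k (suc j) rightward (trans (cong suc (+-suc k j)) k+j≡) (horizontal (suc j) ≤-refl fits)
          (λ c j<c c<C → horizontal c (<-trans (n<1+n j) j<c) c<C))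
  where
  fits : suc j < C
  fits = subst (suc j <_) k+j≡ (s≤s (s≤s (m≤n+m j k)))

∈-rightPath : ∀ {p} i j k → p ∈ rightPath i j k → proj₁ p ≡ i × j ≤ proj₂ p
∈-rightPath i j (suc k) (here refl) = refl , ≤-refl
∈-rightPath i j (suc k) (there p∈) with ∈-rightPath i (suc j) k p∈
... | i≡ , j< = i≡ , <⇒≤ j<

walk-right-exit : ∀ g C i j {e ps} → (∀ c → j ≤ c → transit (g i c) rightward ≢ just up) →
                  Walk g C (at i j rightward) e ps → Exit e → e ≡ outRight i
walk-right-exit g C i j noTurn (more st rest) ex with step-inverse g C i j rightward st
... | up , turn , _ = ⊥-elim (noTurn j ≤-refl turn)
... | rightward , _ , refl with suc j <? C
...   | yes fits rewrite leave-rightward-inside C i j fits =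
        walk-right-exit g C i (suc j) (λ c j<c → noTurn c (<⇒≤ j<c)) rest ex
...   | no edge rewrite leave-rightward-edge C i j edge with refl , _ ← walk-from-exit rest (right i) = refl

walk-outTop⇒topE : ∀ {g C i j d j′ ps} → Walk g C (at i j d) (outTop j′) ps → topE (g 0 j′) ≡ true
walk-outTop⇒topE {g} {C} (more {i} {j} {d} st rest) with step-inverse g C i j d st
walk-outTop⇒topE {g} {C} (more {zero} {j} {d} st done) | up , turn , refl = transit⇒topE (g zero j) d turn
walk-outTop⇒topE {g} {C} (more {suc i} st rest)        | up , _ , refl    = walk-outTop⇒topE rest
walk-outTop⇒topE {g} {C} (more {i} {j} st rest) | rightward , _ , refl with suc j <? C
... | yes fits rewrite leave-rightward-inside C i j fits = walk-outTop⇒topE rest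
... | no edge rewrite leave-rightward-edge C i j edge with () , _ ← walk-from-exit rest (right i)

-- Counting shared crossings

memberᵇ⇒∈ : ∀ p qs → memberᵇ p qs ≡ true → p ∈ qs
memberᵇ⇒∈ (a , b) ((c , d) ∷ qs) eq with a ≡ᵇ c in a≡c | b ≡ᵇ d in b≡d
... | true  | true  = here (cong₂ _,_ (≡ᵇ-sound a≡c) (≡ᵇ-sound b≡d))
... | true  | false = there (memberᵇ⇒∈ (a , b) qs eq)
... | false | _     = there (memberᵇ⇒∈ (a , b) qs eq)

∈⇒memberᵇ : ∀ p qs → p ∈ qs → memberᵇ p qs ≡ true
∈⇒memberᵇ (a , b) ((c , d) ∷ qs) (here refl) rewrite ≡ᵇ-true {a} refl | ≡ᵇ-true {b} refl = refl
∈⇒memberᵇ (a , b) ((c , d) ∷ qs) (there p∈) rewrite ∈⇒memberᵇ (a , b) qs p∈ with (a ≡ᵇ c) ∧ (b ≡ᵇ d)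
... | true  = refl
... | false = refl

memberᵇ-reverse : ∀ p qs → memberᵇ p (reverse qs) ≡ memberᵇ p qs
memberᵇ-reverse p qs = ⇔→≡ (mk⇔ (λ e → ∈⇒memberᵇ p qs (reverse⁻ (memberᵇ⇒∈ p (reverse qs) e)))
                                 (λ e → ∈⇒memberᵇ p (reverse qs) (reverse⁺ (memberᵇ⇒∈ p qs e))))

counted : (Pos → Bool) → List Pos → Pos → Bool
counted f qs p = f p ∧ memberᵇ p qs

crossCount : (Pos → Bool) → List Pos → List Pos → ℕ
crossCount f []       qs = 0
crossCount f (p ∷ ps) qs = (if counted f qs p then 1 else 0) + crossCount f ps qs

isCrossAt-board : ∀ {R C} (G : Grid R C) i j → isCrossAt G (i , j) ≡ isCross (board G i j)
isCrossAt-board G i j with tileAt G i j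
... | nothing     = refl
... | just blank  = refl
... | just rElbow = refl
... | just jElbow = refl
... | just cross  = refl
... | just hline  = refl
... | just vline  = refl

crossings≡crossCount : ∀ {R C} (G : Grid R C) (p q : Path) → crossings G p q ≡ crossCount (isCrossAt G) (proj₁ p) (proj₁ q)
crossings≡crossCount G ([]     , o) q = refl
crossings≡crossCount G (x ∷ ps , o) q = cong (_ +_) (crossings≡crossCount G (ps , o) q)

crossCount-cong : ∀ f f′ ps qs → (∀ p → f p ≡ f′ p) → crossCount f ps qs ≡ crossCount f′ ps qs
crossCount-cong f f′ []       qs f≡f′ = refl
crossCount-cong f f′ (p ∷ ps) qs f≡f′ rewrite f≡f′ p | crossCount-cong f f′ ps qs f≡f′ = refl

crossCount-++ : ∀ f ps ps′ qs → crossCount f (ps ++ ps′) qs ≡ crossCount f ps qs + crossCount f ps′ qs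
crossCount-++ f []       ps′ qs = refl
crossCount-++ f (p ∷ ps) ps′ qs rewrite crossCount-++ f ps ps′ qs =
  sym (+-assoc (if counted f qs p then 1 else 0) (crossCount f ps qs) (crossCount f ps′ qs))

crossCount-infix : ∀ f ps₁ ps₂ ps₃ qs → crossCount f ps₂ qs ≤ crossCount f (ps₁ ++ ps₂ ++ ps₃) qs
crossCount-infix f ps₁ ps₂ ps₃ qs rewrite crossCount-++ f ps₁ (ps₂ ++ ps₃) qs | crossCount-++ f ps₂ ps₃ qs =
  ≤-trans (m≤m+n (crossCount f ps₂ qs) _) (m≤n+m _ (crossCount f ps₁ qs))

crossCount-middle : ∀ f ps₁ ps₂ ps₃ qs → crossCount f ps₁ qs ≡ 0 → crossCount f ps₃ qs ≡ 0 →
                    crossCount f (ps₁ ++ ps₂ ++ ps₃) qs ≡ crossCount f ps₂ qs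
crossCount-middle f ps₁ ps₂ ps₃ qs none₁ none₃
  rewrite crossCount-++ f ps₁ (ps₂ ++ ps₃) qs | crossCount-++ f ps₂ ps₃ qs | none₁ | none₃ = +-identityʳ _

crossCount-reverse : ∀ f ps qs → crossCount f (reverse ps) qs ≡ crossCount f ps qs
crossCount-reverse f []       qs = refl
crossCount-reverse f (p ∷ ps) qs
  rewrite unfold-reverse p ps | crossCount-++ f (reverse ps) [ p ] qs | crossCount-reverse f ps qs =
  trans (+-comm (crossCount f ps qs) _) (cong (_+ crossCount f ps qs) (+-identityʳ _))

crossCount-mono : ∀ f f′ ps qs qs′ → All (λ p → counted f qs p ≡ true → counted f′ qs′ p ≡ true) ps →
                  crossCount f ps qs ≤ crossCount f′ ps qs′
crossCount-mono f f′ []       qs qs′ []       = z≤n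
crossCount-mono f f′ (p ∷ ps) qs qs′ (h ∷ hs) = +-mono-≤ (bit-mono h) (crossCount-mono f f′ ps qs qs′ hs)
  where
  bit-mono : ∀ {a b} → (a ≡ true → b ≡ true) → (if a then 1 else 0) ≤ (if b then 1 else 0)
  bit-mono {false}         _ = z≤n
  bit-mono {true} {true}   _ = ≤-refl
  bit-mono {true} {false}  h = ⊥-elim (true≢false (sym (h refl)))

crossCount-zero : ∀ f ps qs → All (λ p → counted f qs p ≡ false) ps → crossCount f ps qs ≡ 0
crossCount-zero f []       qs []       = refl
crossCount-zero f (p ∷ ps) qs (h ∷ hs) rewrite h = crossCount-zero f ps qs hs

counted-∉ : ∀ f qs p → ¬ p ∈ qs → counted f qs p ≡ false
counted-∉ f qs p p∉ with memberᵇ p qs in eq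
... | true  = ⊥-elim (p∉ (memberᵇ⇒∈ p qs eq))
... | false = ∧-zeroʳ (f p)

crossCount-disjoint : ∀ f ps qs → All (λ p → ¬ p ∈ qs) ps → crossCount f ps qs ≡ 0
crossCount-disjoint f ps qs disjoint = crossCount-zero f ps qs (All.map (counted-∉ f qs _) disjoint)

crossCount≤1 : ∀ f ps qs x₀ → Unique ps → (∀ {p} → p ∈ ps → p ∈ qs → f p ≡ true → p ≡ x₀) →
               crossCount f ps qs ≤ 1
crossCount≤1 f []       qs x₀ _                 _    = z≤n
crossCount≤1 f (p ∷ ps) qs x₀ (p≢ps ∷ uniquePs) only with counted f qs p in eq
... | false = crossCount≤1 f ps qs x₀ uniquePs (λ p∈ → only (there p∈))
... | true with refl ← only (here refl) (memberᵇ⇒∈ p qs (∧-conicalʳ _ _ eq)) (∧-conicalˡ _ _ eq) =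
  s≤s (≤-reflexive (crossCount-zero f ps qs (All.tabulate uncounted)))
  where
  uncounted : ∀ {q} → q ∈ ps → counted f qs q ≡ false
  uncounted {q} q∈ with counted f qs q in eq′
  ... | false = refl
  ... | true  = ⊥-elim (All.lookup p≢ps q∈
                  (sym (only (there q∈) (memberᵇ⇒∈ q qs (∧-conicalʳ _ _ eq′)) (∧-conicalˡ _ _ eq′))))

module CrossCountMap (Q : Pos → Set) (h : Pos → Pos) (h-injective : ∀ p q → Q p → Q q → h p ≡ h q → p ≡ q) where

  memberᵇ-map : ∀ p qs → Q p → All Q qs → memberᵇ (h p) (map h qs) ≡ memberᵇ p qs
  memberᵇ-map p qs qp allQ = ⇔→≡ (mk⇔
    (λ e → ∈⇒memberᵇ p qs (back (map⁻ (memberᵇ⇒∈ (h p) (map h qs) e)) allQ))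
    (λ e → ∈⇒memberᵇ (h p) (map h qs) (map⁺ (Any.map (cong h) (memberᵇ⇒∈ p qs e)))))
    where
    back : ∀ {qs} → Any (λ q → h p ≡ h q) qs → All Q qs → p ∈ qs
    back (here eq) (qq ∷ _)  = here (h-injective _ _ qp qq eq)
    back (there x) (_ ∷ qqs) = there (back x qqs)

  crossCount-map : ∀ f f′ → (∀ p → Q p → f′ (h p) ≡ f p) → ∀ ps qs → All Q ps → All Q qs →
                   crossCount f′ (map h ps) (map h qs) ≡ crossCount f ps qs
  crossCount-map f f′ f′∘h []       qs _          _    = refl
  crossCount-map f f′ f′∘h (p ∷ ps) qs (qp ∷ qps) allQ
    rewrite f′∘h p qp | memberᵇ-map p qs qp allQ | crossCount-map f f′ f′∘h ps qs qps allQ = refl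

  crossCount-reverse-map : ∀ f f′ → (∀ p → Q p → f′ (h p) ≡ f p) → ∀ ps qs → All Q ps → All Q qs →
                           crossCount f′ (reverse (map h ps)) (reverse (map h qs)) ≡ crossCount f ps qs
  crossCount-reverse-map f f′ f′∘h ps qs qps qqs =
    trans (crossCount-reverse f′ (map h ps) _)
          (trans (crossCount-reverse-right (map h ps)) (crossCount-map f f′ f′∘h ps qs qps qqs))
    where
    crossCount-reverse-right : ∀ xs → crossCount f′ xs (reverse (map h qs)) ≡ crossCount f′ xs (map h qs)
    crossCount-reverse-right []       = refl
    crossCount-reverse-right (x ∷ xs) rewrite memberᵇ-reverse x (map h qs) | crossCount-reverse-right xs = refl

-- The standardization w = std_{m,n}(α) and its Rothe bumpless pipedream

module Standardization (α : ℕ → ℕ) (n : ℕ) (lsb : IsLeastSuppBound α n) (w : ℕ → ℕ) (std : IsStd (maxTo α n) n α w)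
           (N : ℕ) (n≤N : n ≤ N) (m≤N : maxTo α n ≤ N) (fix : ∀ j → N < j → w j ≡ j) where

  open IsStd std
  open IsFinPerm perm

  m : ℕ
  m = maxTo α n

  1≤n : 1 ≤ n
  1≤n = proj₁ lsb

  1≤N : 1 ≤ N
  1≤N = ≤-trans 1≤n n≤N

  α≤maxTo : ∀ k a → 1 ≤ a → a ≤ k → α a ≤ maxTo α k
  α≤maxTo zero    (suc a) _ ()
  α≤maxTo (suc k) a 1≤a a≤k with a ≟ suc k
  ... | yes refl = m≤m⊔n (α (suc k)) (maxTo α k)
  ... | no a≢    = ≤-trans (α≤maxTo k a 1≤a (≤-pred (≤∧≢⇒< a≤k a≢))) (m≤n⊔m (α (suc k)) (maxTo α k))

  α≤m : ∀ a → 1 ≤ a → a ≤ n → α a ≤ m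
  α≤m = α≤maxTo n

  -- w fixes every point beyond N, so by injectivity it maps [N] into itself.
  w≤N : ∀ i → 1 ≤ i → i ≤ N → w i ≤ N
  w≤N i 1≤i i≤N with w i ≤? N
  ... | yes w≤ = w≤
  ... | no w≰ = ⊥-elim (<⇒≢ (≤-<-trans i≤N (≰⇒> w≰))
                            (sym (injective (w i) i (≤-trans 1≤i (≤-trans i≤N (<⇒≤ (≰⇒> w≰)))) 1≤i
                                            (fix (w i) (≰⇒> w≰)))))

  w-onto : ∀ c → 1 ≤ c → c ≤ N → Σ ℕ λ i → 1 ≤ i × i ≤ N × w i ≡ c
  w-onto c 1≤c c≤N with surjective c 1≤c
  ... | i , 1≤i , wi≡c with i ≤? N
  ...   | yes i≤N = i , 1≤i , i≤N , wi≡c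
  ...   | no i≰N  = ⊥-elim (<⇒≢ (≤-<-trans c≤N (≰⇒> i≰N)) (trans (sym wi≡c) (fix i (≰⇒> i≰N))))

  elbow-columns-distinct : ∀ {ka kb} → 1 ≤ ka → 1 ≤ kb → ka ≢ kb → w ka ∸ 1 ≢ w kb ∸ 1
  elbow-columns-distinct 1≤ka 1≤kb ka≢kb =
    ≢-pred (positive _ 1≤ka) (positive _ 1≤kb) (λ eq → ka≢kb (injective _ _ 1≤ka 1≤kb eq))

  reverse-index : ∀ k → 1 ≤ k → k ≤ n → 1 ≤ suc n ∸ k × suc n ∸ k ≤ n
  reverse-index (suc k) _ (s≤s k≤n) = subst (1 ≤_) (sym (+-∸-assoc 1 k≤n)) (s≤s z≤n) , m∸n≤m n k

  reverse-involutive : ∀ {a} → a ≤ n → suc n ∸ (suc n ∸ a) ≡ a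
  reverse-involutive a≤n = m∸[m∸n]≡n (≤-trans a≤n (n≤1+n n))

  -- Entry k of r_{m+1,n}(α) equals m + 1 exactly when α (n + 1 - k) = 0.
  isPad : ℕ → Bool
  isPad k = (suc m ∸ α (suc n ∸ k)) ≡ᵇ suc m

  padRank : ℕ → ℕ
  padRank = countTo isPad

  isPad-false : ∀ k → 1 ≤ k → k ≤ n → 0 < α (suc n ∸ k) → isPad k ≡ false
  isPad-false k 1≤k k≤n pos with reverse-index k 1≤k k≤n
  ... | 1≤a , a≤n = ≡ᵇ-false (λ eq → <-irrefl eq (∸-monoʳ-< pos (≤-trans (α≤m _ 1≤a a≤n) (n≤1+n m))))

  isPad-true : ∀ k → α (suc n ∸ k) ≡ 0 → isPad k ≡ true
  isPad-true k α≡0 rewrite α≡0 = ≡ᵇ-true {suc m} refl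

  isPad⇒α≡0 : ∀ k → isPad k ≡ true → α (suc n ∸ k) ≡ 0
  isPad⇒α≡0 k eq with α (suc n ∸ k)
  ... | zero  = refl
  ... | suc x = ⊥-elim (<-irrefl (≡ᵇ-sound eq) (s≤s (m∸n≤m m x)))

  w-head-positive : ∀ k → 1 ≤ k → k ≤ n → 0 < α (suc n ∸ k) → w k ≡ suc m ∸ α (suc n ∸ k)
  w-head-positive k 1≤k k≤n pos rewrite head k 1≤k k≤n | isPad-false k 1≤k k≤n pos = refl

  w-head-pad : ∀ k → 1 ≤ k → k ≤ n → α (suc n ∸ k) ≡ 0 → w k ≡ m + padRank k
  w-head-pad k 1≤k k≤n α≡0 rewrite head k 1≤k k≤n | isPad-true k α≡0 = refl

  padRank-positive : ∀ k → 1 ≤ k → isPad k ≡ true → 1 ≤ padRank k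
  padRank-positive (suc k) _ eq rewrite eq = s≤s z≤n

  padRank-mono : ∀ {a b} → a ≤ b → padRank a ≤ padRank b
  padRank-mono {a} {zero}  z≤n = ≤-refl
  padRank-mono {a} {suc b} a≤b with a ≟ suc b
  ... | yes refl = ≤-refl
  ... | no a≢    = ≤-trans (padRank-mono {a} {b} (≤-pred (≤∧≢⇒< a≤b a≢))) (m≤n+m (padRank b) _)

  padRank-suc : ∀ k → padRank (suc k) ≤ suc (padRank k)
  padRank-suc k with isPad (suc k)
  ... | true  = ≤-refl
  ... | false = n≤1+n _

  -- padRank climbs in unit steps, so it attains every value up to padRank k at a padded position.
  padRank-attains : ∀ k t → 1 ≤ t → t ≤ padRank k →
                    Σ ℕ λ k′ → 1 ≤ k′ × k′ ≤ k × isPad k′ ≡ true × padRank k′ ≡ t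
  padRank-attains zero    (suc t) _ ()
  padRank-attains (suc k) t 1≤t t≤ with t ≤? padRank k
  ... | yes t≤′ with k′ , 1≤k′ , k′≤k , pad , rank ← padRank-attains k t 1≤t t≤′ =
    k′ , 1≤k′ , ≤-trans k′≤k (n≤1+n k) , pad , rank
  ... | no t≰ = at-suc-k (isPad (suc k)) refl
    where
    at-suc-k : ∀ b → isPad (suc k) ≡ b →
               Σ ℕ λ k′ → 1 ≤ k′ × k′ ≤ suc k × isPad k′ ≡ true × padRank k′ ≡ t
    at-suc-k true  pad = suc k , s≤s z≤n , ≤-refl , pad , ≤-antisym (≤-trans (padRank-suc k) (≰⇒> t≰)) t≤
    at-suc-k false pad = ⊥-elim (t≰ (subst (t ≤_) (cong (λ b → (if b then 1 else 0) + padRank k) pad) t≤))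

  pad⇒large : ∀ k → 1 ≤ k → k ≤ n → α (suc n ∸ k) ≡ 0 → m < w k
  pad⇒large k 1≤k k≤n α≡0 =
    subst (m <_) (sym (w-head-pad k 1≤k k≤n α≡0)) (m<m+n m (padRank-positive k 1≤k (isPad-true k α≡0)))

  small⇒positive : ∀ k → 1 ≤ k → k ≤ n → w k ≤ m → 0 < α (suc n ∸ k)
  small⇒positive k 1≤k k≤n w≤m with α (suc n ∸ k) in α≡
  ... | zero  = ⊥-elim (<⇒≱ (pad⇒large k 1≤k k≤n α≡) w≤m)
  ... | suc _ = s≤s z≤n

  w-head-large : ∀ k → 1 ≤ k → k ≤ n → m < w k → w k ≡ m + padRank k
  w-head-large k 1≤k k≤n m<w with α (suc n ∸ k) ≟ 0
  ... | yes α≡0 = w-head-pad k 1≤k k≤n α≡0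
  ... | no α≢0  = ⊥-elim (<⇒≱ m<w (subst (_≤ m) (sym (w-head-positive k 1≤k k≤n pos)) (suc[m]∸n≤m m pos)))
    where
    pos : 0 < α (suc n ∸ k)
    pos = n≢0⇒n>0 α≢0

  large-heads-increasing : ∀ k₁ k₂ → 1 ≤ k₁ → k₁ ≤ n → 1 ≤ k₂ → k₂ ≤ n →
                           m < w k₁ → w k₁ < w k₂ → k₁ < k₂
  large-heads-increasing k₁ k₂ 1≤k₁ k₁≤n 1≤k₂ k₂≤n m<w₁ w₁<w₂ with k₁ <? k₂
  ... | yes k₁<k₂ = k₁<k₂
  ... | no k₁≮k₂ = ⊥-elim (<⇒≱
          (subst₂ _<_ (w-head-large k₁ 1≤k₁ k₁≤n m<w₁)
                      (w-head-large k₂ 1≤k₂ k₂≤n (<-trans m<w₁ w₁<w₂)) w₁<w₂)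
          (+-monoʳ-≤ m (padRank-mono (≮⇒≥ k₁≮k₂))))

  -- The large head values are m + 1, …, m + padRank n in order, so a larger value lies in the tail.
  large-tail-above-heads : ∀ c t → m < c → n < t → w t ≡ c → ∀ k → 1 ≤ k → k ≤ n → w k < c
  large-tail-above-heads c t m<c n<t wt≡c k 1≤k k≤n with w k <? c
  ... | yes w<c = w<c
  ... | no w≮c = ⊥-elim (collision (padRank-attains k (c ∸ m) (m<n⇒0<n∸m m<c) c∸m≤rank))
    where
    c∸m≤rank : c ∸ m ≤ padRank k
    c∸m≤rank = subst (c ∸ m ≤_) (m+n∸m≡n m (padRank k))
                 (∸-monoˡ-≤ m (subst (c ≤_) (w-head-large k 1≤k k≤n (<-≤-trans m<c (≮⇒≥ w≮c))) (≮⇒≥ w≮c)))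
    collision : (Σ ℕ λ k′ → 1 ≤ k′ × k′ ≤ k × isPad k′ ≡ true × padRank k′ ≡ c ∸ m) → ⊥
    collision (k′ , 1≤k′ , k′≤k , pad , rank) =
      <⇒≢ (≤-<-trans (≤-trans k′≤k k≤n) n<t) (injective k′ t 1≤k′ (≤-trans 1≤n (<⇒≤ n<t)) w≡)
      where
      open ≡-Reasoning
      w≡ : w k′ ≡ w t
      w≡ = begin
        w k′               ≡⟨ w-head-pad k′ 1≤k′ (≤-trans k′≤k k≤n) (isPad⇒α≡0 k′ pad) ⟩
        m + padRank k′     ≡⟨ cong (m +_) rank ⟩
        m + (c ∸ m)        ≡⟨ m+[n∸m]≡n (<⇒≤ m<c) ⟩
        c                  ≡⟨ sym wt≡c ⟩
        w t                ∎

  α-positive≡w-small : ∀ i → i < n → (0 <ᵇ α (n ∸ i)) ≡ (w (suc i) <ᵇ suc m)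
  α-positive≡w-small i i<n with reverse-index (suc i) (s≤s z≤n) i<n | α (n ∸ i) ≟ 0
  ... | _ | yes α≡0 rewrite α≡0 =
    sym (<ᵇ-false (λ w≤m → <⇒≱ (pad⇒large (suc i) (s≤s z≤n) i<n α≡0) (≤-pred w≤m)))
  ... | 1≤a , a≤n | no α≢0 rewrite <ᵇ-true (n≢0⇒n>0 α≢0) | w-head-positive (suc i) (s≤s z≤n) i<n (n≢0⇒n>0 α≢0) =
    sym (<ᵇ-true (∸-monoʳ-< (n≢0⇒n>0 α≢0) (≤-trans (α≤m _ 1≤a a≤n) (n≤1+n m))))

  -- The Rothe bumpless pipedream of w (rows and columns 1-indexed here): the pipe entering column
  -- w r rises to row r, turns right there and runs to the right edge.  vertical r c says that the
  -- pipe of column c turns in a row above r, hence passes row r vertically.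
  elbowAt : ℕ → ℕ → Bool
  elbowAt zero    c = false
  elbowAt (suc r) c = w (suc r) ≡ᵇ c

  vertical : ℕ → ℕ → Bool
  vertical zero    c = false
  vertical (suc r) c = vertical r c ∨ elbowAt r c

  rothe : ℕ → ℕ → Tile
  rothe r c = if w r ≡ᵇ c then rElbow
              else if w r <ᵇ c then (if vertical r c then cross else hline)
              else (if vertical r c then vline else blank)

  vertical-sound : ∀ r c → vertical r c ≡ true → Σ ℕ λ i → 1 ≤ i × i < r × w i ≡ c
  vertical-sound (suc r) c v with vertical r c in v′
  ... | true with i , 1≤i , i<r , wi≡c ← vertical-sound r c v′ = i , 1≤i , ≤-trans i<r (n≤1+n r) , wi≡c
  vertical-sound (suc (suc r)) c v | false = suc r , s≤s z≤n , ≤-refl , ≡ᵇ-sound v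

  vertical-complete : ∀ r c i → 1 ≤ i → i < r → w i ≡ c → vertical r c ≡ true
  vertical-complete (suc r) c i 1≤i (s≤s i≤r) wi≡c with i ≟ r
  vertical-complete (suc r) c (suc i) 1≤i (s≤s i≤r) wi≡c | yes refl
    rewrite ≡ᵇ-true wi≡c = ∨-zeroʳ (vertical (suc i) c)
  ... | no i≢r rewrite vertical-complete r c i 1≤i (≤∧≢⇒< i≤r i≢r) wi≡c = refl

  vertical-false : ∀ r c → (∀ i → 1 ≤ i → i < r → w i ≢ c) → vertical r c ≡ false
  vertical-false r c none with vertical r c in v
  ... | true with i , 1≤i , i<r , wi≡c ← vertical-sound r c v = ⊥-elim (none i 1≤i i<r wi≡c)
  ... | false = refl

  vertical-below-all : ∀ c → 1 ≤ c → c ≤ N → vertical (suc N) c ≡ true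
  vertical-below-all c 1≤c c≤N with i , 1≤i , i≤N , wi≡c ← w-onto c 1≤c c≤N =
    vertical-complete (suc N) c i 1≤i (s≤s i≤N) wi≡c

  vertical-at-elbow : ∀ r c → 1 ≤ r → w r ≡ c → vertical r c ≡ false
  vertical-at-elbow r c 1≤r wr≡c =
    vertical-false r c (λ i 1≤i i<r wi≡c → <-irrefl (injective i r 1≤i 1≤r (trans wi≡c (sym wr≡c))) i<r)

  rothe-elbow : ∀ r c → w r ≡ c → rothe r c ≡ rElbow
  rothe-elbow r c wr≡c rewrite ≡ᵇ-true wr≡c = refl

  rothe-cross : ∀ r c → w r < c → vertical r c ≡ true → rothe r c ≡ cross
  rothe-cross r c w<c v rewrite ≡ᵇ-false (<⇒≢ w<c) | <ᵇ-true w<c | v = refl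

  rothe-hline : ∀ r c → w r < c → vertical r c ≡ false → rothe r c ≡ hline
  rothe-hline r c w<c v rewrite ≡ᵇ-false (<⇒≢ w<c) | <ᵇ-true w<c | v = refl

  rothe-vline : ∀ r c → c < w r → vertical r c ≡ true → rothe r c ≡ vline
  rothe-vline r c c<w v rewrite ≡ᵇ-false (>⇒≢ c<w) | <ᵇ-false (<⇒≯ c<w) | v = refl

  data RotheView (r c : ℕ) : Tile → Set where
    elbow      : w r ≡ c → RotheView r c rElbow
    crossing   : w r < c → vertical r c ≡ true → RotheView r c cross
    horizontal : w r < c → vertical r c ≡ false → RotheView r c hline
    upright    : c < w r → vertical r c ≡ true → RotheView r c vline
    empty      : c < w r → vertical r c ≡ false → RotheView r c blank

  rothe-view : ∀ r c → RotheView r c (rothe r c)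
  rothe-view r c with <-cmp (w r) c
  ... | tri≈ _ w≡c _ rewrite ≡ᵇ-true w≡c = elbow w≡c
  ... | tri< w<c _ _ rewrite ≡ᵇ-false (<⇒≢ w<c) | <ᵇ-true w<c with vertical r c in v
  ...   | true  = crossing w<c v
  ...   | false = horizontal w<c v
  rothe-view r c | tri> _ _ c<w rewrite ≡ᵇ-false (>⇒≢ c<w) | <ᵇ-false (<⇒≯ c<w) with vertical r c in v
  ...   | true  = upright c<w v
  ...   | false = empty c<w v

  elbowAt-≡ᵇ : ∀ r c → 1 ≤ r → elbowAt r c ≡ (w r ≡ᵇ c)
  elbowAt-≡ᵇ (suc r) c _ = refl

  module _ (r c : ℕ) (1≤r : 1 ≤ r) where

    leftE-rothe : leftE (rothe r c) ≡ (w r <ᵇ c)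
    leftE-rothe with rothe r c | rothe-view r c
    ... | _ | elbow refl       = sym (<ᵇ-false {w r} (<-irrefl refl))
    ... | _ | crossing w<c _   = sym (<ᵇ-true w<c)
    ... | _ | horizontal w<c _ = sym (<ᵇ-true w<c)
    ... | _ | upright c<w _    = sym (<ᵇ-false (<⇒≯ c<w))
    ... | _ | empty c<w _      = sym (<ᵇ-false (<⇒≯ c<w))

    rightE-rothe : rightE (rothe r c) ≡ (w r <ᵇ suc c)
    rightE-rothe with rothe r c | rothe-view r c
    ... | _ | elbow refl       = sym (<ᵇ-true {w r} ≤-refl)
    ... | _ | crossing w<c _   = sym (<ᵇ-true (m<n⇒m<1+n w<c))
    ... | _ | horizontal w<c _ = sym (<ᵇ-true (m<n⇒m<1+n w<c))
    ... | _ | upright c<w _    = sym (<ᵇ-false (≤⇒≯ c<w))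
    ... | _ | empty c<w _      = sym (<ᵇ-false (≤⇒≯ c<w))

    topE-rothe : topE (rothe r c) ≡ vertical r c
    topE-rothe with rothe r c | rothe-view r c
    ... | _ | elbow w≡c      = sym (vertical-at-elbow r c 1≤r w≡c)
    ... | _ | crossing _ v   = sym v
    ... | _ | horizontal _ v = sym v
    ... | _ | upright _ v    = sym v
    ... | _ | empty _ v      = sym v

    bottomE-rothe : bottomE (rothe r c) ≡ vertical (suc r) c
    bottomE-rothe rewrite elbowAt-≡ᵇ r c 1≤r with rothe r c | rothe-view r c
    ... | _ | elbow w≡c        rewrite ≡ᵇ-true w≡c = sym (∨-zeroʳ _)
    ... | _ | crossing _ v     rewrite v = refl
    ... | _ | horizontal w<c v rewrite v | ≡ᵇ-false (<⇒≢ w<c) = refl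
    ... | _ | upright _ v      rewrite v = refl
    ... | _ | empty c<w v      rewrite v | ≡ᵇ-false (>⇒≢ c<w) = refl

    rothe-transit-up : vertical r c ≡ true → transit (rothe r c) up ≡ just up
    rothe-transit-up v with rothe r c | rothe-view r c
    ... | _ | elbow w≡c       = ⊥-elim (true≢false (trans (sym v) (vertical-at-elbow r c 1≤r w≡c)))
    ... | _ | crossing _ _    = refl
    ... | _ | horizontal _ v′ = ⊥-elim (true≢false (trans (sym v) v′))
    ... | _ | upright _ _     = refl
    ... | _ | empty _ v′      = ⊥-elim (true≢false (trans (sym v) v′))

  rothe-transit-rightward : ∀ r c → w r < c → transit (rothe r c) rightward ≡ just rightward
  rothe-transit-rightward r c w<c with rothe r c | rothe-view r c
  ... | _ | elbow refl      = ⊥-elim (<-irrefl refl w<c)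
  ... | _ | crossing _ _    = refl
  ... | _ | horizontal _ _  = refl
  ... | _ | upright c<w _   = ⊥-elim (<-asym w<c c<w)
  ... | _ | empty c<w _     = ⊥-elim (<-asym w<c c<w)

  rothe-no-up-turn : ∀ r c → transit (rothe r c) rightward ≢ just up
  rothe-no-up-turn r c with rothe r c | rothe-view r c
  ... | _ | elbow _        = λ ()
  ... | _ | crossing _ _   = λ ()
  ... | _ | horizontal _ _ = λ ()
  ... | _ | upright _ _    = λ ()
  ... | _ | empty _ _      = λ ()

  rotheᵇ : Board
  rotheᵇ i j = rothe (suc i) (suc j)

  rotheᵇ-horizontal : ∀ i j → rightE (rotheᵇ i j) ≡ leftE (rotheᵇ i (suc j))
  rotheᵇ-horizontal i j = trans (rightE-rothe (suc i) (suc j) (s≤s z≤n)) (sym (leftE-rothe (suc i) (suc (suc j)) (s≤s z≤n)))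

  rotheᵇ-vertical : ∀ i j → bottomE (rotheᵇ i j) ≡ topE (rotheᵇ (suc i) j)
  rotheᵇ-vertical i j = trans (bottomE-rothe (suc i) (suc j) (s≤s z≤n)) (sym (topE-rothe (suc (suc i)) (suc j) (s≤s z≤n)))

  rotheᵇ-column : ∀ k r → 1 ≤ k → k ∸ 1 < r → transit (rotheᵇ r (w k ∸ 1)) up ≡ just up
  rotheᵇ-column k r 1≤k k-1<r rewrite suc[n∸1]≡n (positive k 1≤k) =
    rothe-transit-up (suc r) (w k) (s≤s z≤n)
      (vertical-complete (suc r) (w k) k 1≤k (s≤s (subst (_≤ r) (suc[n∸1]≡n 1≤k) k-1<r)) refl)

  rotheᵇ-corner : ∀ k → 1 ≤ k → rotheᵇ (k ∸ 1) (w k ∸ 1) ≡ rElbow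
  rotheᵇ-corner (suc k) 1≤k =
    subst (λ c → rothe (suc k) c ≡ rElbow) (sym (suc[n∸1]≡n (positive (suc k) 1≤k))) (rothe-elbow (suc k) _ refl)

  rotheᵇ-row : ∀ k j → 1 ≤ k → w k ∸ 1 < j → transit (rotheᵇ (k ∸ 1) j) rightward ≡ just rightward
  rotheᵇ-row (suc k) j 1≤k c-1<j =
    rothe-transit-rightward (suc k) (suc j) (subst (_< suc j) (suc[n∸1]≡n (positive (suc k) 1≤k)) (s≤s c-1<j))

  walk-up-rothe : ∀ g k lo → 1 ≤ k → k ∸ 1 ≤ lo → lo < N →
                  (∀ r → lo < r → r < N → g r (w k ∸ 1) ≡ rotheᵇ r (w k ∸ 1)) →
                  Walk g N (at (N ∸ 1) (w k ∸ 1) up) (at lo (w k ∸ 1) up) (upPath (w k ∸ 1) lo (N ∸ suc lo))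
  walk-up-rothe g k lo 1≤k k-1≤lo lo<N g≡ =
    subst (λ x → Walk g N (at x (w k ∸ 1) up) (at lo (w k ∸ 1) up) (upPath (w k ∸ 1) lo (N ∸ suc lo)))
          ([m∸1+n]+n≡m∸1 lo<N)
          (walk-up g N (w k ∸ 1) lo (N ∸ suc lo) vertical-run)
    where
    vertical-run : ∀ r → lo < r → r ≤ (N ∸ suc lo) + lo → transit (g r (w k ∸ 1)) up ≡ just up
    vertical-run r lo<r r≤ =
      trans (cong (λ t → transit t up) (g≡ r lo<r (≤-<-trans (subst (r ≤_) ([m∸1+n]+n≡m∸1 lo<N) r≤) (n∸1<n 1≤N))))
            (rotheᵇ-column k r 1≤k (≤-<-trans k-1≤lo lo<r))

  walk-right-rothe : ∀ g k j d → 1 ≤ k → w k ∸ 1 ≤ j → j < N → transit (g (k ∸ 1) j) d ≡ just rightward →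
                     (∀ c → j < c → c < N → g (k ∸ 1) c ≡ rotheᵇ (k ∸ 1) c) →
                     Walk g N (at (k ∸ 1) j d) (outRight (k ∸ 1)) (rightPath (k ∸ 1) j (N ∸ j))
  walk-right-rothe g k j d 1≤k c-1≤j j<N turn g≡ =
    subst (λ x → Walk g N (at (k ∸ 1) j d) (outRight (k ∸ 1)) (rightPath (k ∸ 1) j x)) (sym (m∸n≡suc[m∸1+n] j<N))
      (walk-right g N (k ∸ 1) (N ∸ suc j) j d (trans (cong suc ([m∸1+n]+n≡m∸1 j<N)) (suc[n∸1]≡n 1≤N)) turn
         (λ c j<c c<N → trans (cong (λ t → transit t rightward) (g≡ c j<c c<N))
                              (rotheᵇ-row k c 1≤k (≤-<-trans c-1≤j j<c))))

  -- From a left-to-top pipedream T to a bumpless pipedream B of w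

  module FromLTBPD (T : Grid n m) (ltbpd : IsLTBPD α n m T) where

    open IsLTBPD ltbpd

    Tᵇ : Board
    Tᵇ = board T

    Tᵇ-left : ∀ i → i < n → 0 < m → leftE (Tᵇ i 0) ≡ (0 <ᵇ α (suc i))
    Tᵇ-left i i<n 0<m rewrite board-inside T i 0 i<n 0<m =
      trans (leftBoundary (fromℕ< i<n) (fromℕ< 0<m) (toℕ-fromℕ< 0<m)) (cong (λ x → 0 <ᵇ α (suc x)) (toℕ-fromℕ< i<n))

    Tᵇ-top : ∀ j → j < m → topE (Tᵇ 0 j) ≡ true → Σ ℕ λ k → 1 ≤ k × k ≤ n × α k ≡ suc j
    Tᵇ-top j j<m top≡ rewrite board-inside T 0 j 1≤n j<m
      with k , 1≤k , k≤n , αk≡ ← topBoundary (fromℕ< 1≤n) (fromℕ< j<m) (toℕ-fromℕ< 1≤n) top≡ =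
      k , 1≤k , k≤n , trans αk≡ (cong suc (toℕ-fromℕ< j<m))

    Tᵇ-bottom : ∀ j → j < m → bottomE (Tᵇ (n ∸ 1) j) ≡ false
    Tᵇ-bottom j j<m rewrite board-inside T (n ∸ 1) j (n∸1<n 1≤n) j<m =
      bottomEmpty _ _ (trans (cong suc (toℕ-fromℕ< (n∸1<n 1≤n))) (suc[n∸1]≡n 1≤n))

    Tᵇ-right : ∀ i → i < n → 0 < m → rightE (Tᵇ i (m ∸ 1)) ≡ false
    Tᵇ-right i i<n 0<m rewrite board-inside T i (m ∸ 1) i<n (n∸1<n 0<m) =
      rightEmpty _ _ (trans (cong suc (toℕ-fromℕ< (n∸1<n 0<m))) (suc[n∸1]≡n 0<m))

    pathT : ℕ → List Pos
    pathT a = proj₁ (pipeFromLeft T a)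

    walk-T : ∀ a → 1 ≤ a → a ≤ n → 0 < α a → Walk Tᵇ m (at (a ∸ 1) 0 rightward) (outTop (α a ∸ 1)) (pathT a)
    walk-T a 1≤a a≤n pos = view-outTop (trace-view T (n + m) (a ∸ 1) 0 rightward) (pipes a 1≤a a≤n pos)

    Bᵇ : Board
    Bᵇ i j = if (i <ᵇ n) ∧ (j <ᵇ m) then rot180 (Tᵇ (n ∸ suc i) (m ∸ suc j)) else rotheᵇ i j

    B : Grid N N
    B a b = Bᵇ (toℕ a) (toℕ b)

    Bᵇ-region : ∀ {i j} → i < n → j < m → Bᵇ i j ≡ rot180 (Tᵇ (n ∸ suc i) (m ∸ suc j))
    Bᵇ-region i<n j<m rewrite <ᵇ-true i<n | <ᵇ-true j<m = refl

    Bᵇ-below : ∀ {i j} → n ≤ i → Bᵇ i j ≡ rotheᵇ i j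
    Bᵇ-below n≤i rewrite <ᵇ-false (≤⇒≯ n≤i) = refl

    Bᵇ-beside : ∀ {i j} → m ≤ j → Bᵇ i j ≡ rotheᵇ i j
    Bᵇ-beside {i} m≤j rewrite <ᵇ-false (≤⇒≯ m≤j) | ∧-zeroʳ (i <ᵇ n) = refl

    board-B : ∀ i j → i < N → j < N → board B i j ≡ Bᵇ i j
    board-B i j i<N j<N rewrite board-inside B i j i<N j<N | toℕ-fromℕ< i<N | toℕ-fromℕ< j<N = refl

    module RotT = Rot180 n m Tᵇ Bᵇ (λ i j → Bᵇ-region)

    -- The top edge of the region is glued to row n + 1 of the Rothe pipedream: T's pipes leave
    -- through the top exactly in the columns whose pipes turn in rows 1, …, n.
    topE-T≡vertical : ∀ j → j < m → topE (Tᵇ 0 (m ∸ suc j)) ≡ vertical (suc n) (suc j)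
    topE-T≡vertical j j<m = ⇔→≡ (mk⇔ to from)
      where
      to : topE (Tᵇ 0 (m ∸ suc j)) ≡ true → vertical (suc n) (suc j) ≡ true
      to top≡ with a , 1≤a , a≤n , αa≡ ← Tᵇ-top (m ∸ suc j) (mirror-< j<m) top≡ with reverse-index a 1≤a a≤n
      ... | 1≤k , k≤n = vertical-complete (suc n) (suc j) (suc n ∸ a) 1≤k (s≤s k≤n) w≡
        where
        pos : 0 < α (suc n ∸ (suc n ∸ a))
        pos rewrite reverse-involutive a≤n | αa≡ = s≤s z≤n
        w≡ : w (suc n ∸ a) ≡ suc j
        w≡ = trans (w-head-positive (suc n ∸ a) 1≤k k≤n pos)
                   (trans (cong (λ x → suc m ∸ α x) (reverse-involutive a≤n))
                          (trans (cong (suc m ∸_) αa≡) (m∸[m∸n]≡n j<m)))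
      from : vertical (suc n) (suc j) ≡ true → topE (Tᵇ 0 (m ∸ suc j)) ≡ true
      from v with i , 1≤i , s≤s i≤n , wi≡ ← vertical-sound (suc n) (suc j) v
        with α (suc n ∸ i) ≟ 0 | reverse-index i 1≤i i≤n
      ... | yes α≡0 | _ = ⊥-elim (<⇒≱ (pad⇒large i 1≤i i≤n α≡0) (subst (_≤ m) (sym wi≡) j<m))
      ... | no α≢0 | 1≤a , a≤n =
        subst (λ y → topE (Tᵇ 0 y) ≡ true)
              (∸-flip pos (α≤m _ 1≤a a≤n) (trans (sym wi≡) (w-head-positive i 1≤i i≤n pos)))
              (walk-outTop⇒topE (walk-T (suc n ∸ i) 1≤a a≤n pos))
        where pos = n≢0⇒n>0 α≢0

    Tᵇ-left-mirror : ∀ i → i < n → 0 < m → leftE (Tᵇ (n ∸ suc i) 0) ≡ (w (suc i) <ᵇ suc m)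
    Tᵇ-left-mirror i i<n 0<m = begin
      leftE (Tᵇ (n ∸ suc i) 0)      ≡⟨ Tᵇ-left (n ∸ suc i) (mirror-< i<n) 0<m ⟩
      (0 <ᵇ α (suc (n ∸ suc i)))    ≡⟨ cong (λ x → 0 <ᵇ α x) (sym (m∸n≡suc[m∸1+n] i<n)) ⟩
      (0 <ᵇ α (n ∸ i))              ≡⟨ α-positive≡w-small i i<n ⟩
      (w (suc i) <ᵇ suc m)          ∎
      where open ≡-Reasoning

    region? : ∀ i j → (i < n × j < m) ⊎ Bᵇ i j ≡ rotheᵇ i j
    region? i j with i <? n | j <? m
    ... | yes i<n | yes j<m = inj₁ (i<n , j<m)
    ... | no i≮n  | _       = inj₂ (Bᵇ-below (≮⇒≥ i≮n))
    ... | yes _   | no j≮m  = inj₂ (Bᵇ-beside (≮⇒≥ j≮m))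

    Bᵇ-horizontal : ∀ i j → rightE (Bᵇ i j) ≡ leftE (Bᵇ i (suc j))
    Bᵇ-horizontal i j with i <? n | suc j <? m | j <? m
    ... | no i≮n | _ | _ rewrite Bᵇ-below {i} {j} (≮⇒≥ i≮n) | Bᵇ-below {i} {suc j} (≮⇒≥ i≮n) = rotheᵇ-horizontal i j
    ... | yes _ | no _ | no j≮m
      rewrite Bᵇ-beside {i} {j} (≮⇒≥ j≮m) | Bᵇ-beside {i} {suc j} (≤-trans (≮⇒≥ j≮m) (n≤1+n j)) = rotheᵇ-horizontal i j
    ... | yes i<n | yes j+1<m | _ = begin
      rightE (Bᵇ i j)
        ≡⟨ cong rightE (Bᵇ-region i<n (<-trans (n<1+n j) j+1<m)) ⟩
      rightE (rot180 (Tᵇ (n ∸ suc i) (m ∸ suc j)))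
        ≡⟨ rightE-rot180 _ ⟩
      leftE (Tᵇ (n ∸ suc i) (m ∸ suc j))
        ≡⟨ cong (λ x → leftE (Tᵇ (n ∸ suc i) x)) (m∸n≡suc[m∸1+n] j+1<m) ⟩
      leftE (Tᵇ (n ∸ suc i) (suc (m ∸ suc (suc j))))
        ≡⟨ sym (board-horizontal wellTiled _ _ (mirror-< i<n)
           (subst (_< m) (m∸n≡suc[m∸1+n] j+1<m) (mirror-< (<-trans (n<1+n j) j+1<m)))) ⟩
      rightE (Tᵇ (n ∸ suc i) (m ∸ suc (suc j)))
        ≡⟨ sym (leftE-rot180 _) ⟩
      leftE (rot180 (Tᵇ (n ∸ suc i) (m ∸ suc (suc j))))
        ≡⟨ cong leftE (sym (Bᵇ-region i<n j+1<m)) ⟩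
      leftE (Bᵇ i (suc j)) ∎
      where open ≡-Reasoning
    ... | yes i<n | no j+1≮m | yes j<m = begin
      rightE (Bᵇ i j)
        ≡⟨ cong rightE (Bᵇ-region i<n j<m) ⟩
      rightE (rot180 (Tᵇ (n ∸ suc i) (m ∸ suc j)))
        ≡⟨ rightE-rot180 _ ⟩
      leftE (Tᵇ (n ∸ suc i) (m ∸ suc j))
        ≡⟨ cong (λ x → leftE (Tᵇ (n ∸ suc i) x)) (last-index j+1≮m j<m) ⟩
      leftE (Tᵇ (n ∸ suc i) 0)
        ≡⟨ Tᵇ-left-mirror i i<n (≤-<-trans z≤n j<m) ⟩
      (w (suc i) <ᵇ suc m)
        ≡⟨ cong (λ x → w (suc i) <ᵇ suc x) (sym (≤-antisym j<m (≮⇒≥ j+1≮m))) ⟩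
      (w (suc i) <ᵇ suc (suc j))
        ≡⟨ sym (leftE-rothe (suc i) (suc (suc j)) (s≤s z≤n)) ⟩
      leftE (rotheᵇ i (suc j))
        ≡⟨ cong leftE (sym (Bᵇ-beside (≮⇒≥ j+1≮m))) ⟩
      leftE (Bᵇ i (suc j)) ∎
      where open ≡-Reasoning

    Bᵇ-vertical : ∀ i j → bottomE (Bᵇ i j) ≡ topE (Bᵇ (suc i) j)
    Bᵇ-vertical i j with j <? m | suc i <? n | i <? n
    ... | no j≮m | _ | _ rewrite Bᵇ-beside {i} {j} (≮⇒≥ j≮m) | Bᵇ-beside {suc i} {j} (≮⇒≥ j≮m) = rotheᵇ-vertical i j
    ... | yes _ | no _ | no i≮n
      rewrite Bᵇ-below {i} {j} (≮⇒≥ i≮n) | Bᵇ-below {suc i} {j} (≤-trans (≮⇒≥ i≮n) (n≤1+n i)) = rotheᵇ-vertical i j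
    ... | yes j<m | yes i+1<n | _ = begin
      bottomE (Bᵇ i j)
        ≡⟨ cong bottomE (Bᵇ-region (<-trans (n<1+n i) i+1<n) j<m) ⟩
      bottomE (rot180 (Tᵇ (n ∸ suc i) (m ∸ suc j)))
        ≡⟨ bottomE-rot180 _ ⟩
      topE (Tᵇ (n ∸ suc i) (m ∸ suc j))
        ≡⟨ cong (λ x → topE (Tᵇ x (m ∸ suc j))) (m∸n≡suc[m∸1+n] i+1<n) ⟩
      topE (Tᵇ (suc (n ∸ suc (suc i))) (m ∸ suc j))
        ≡⟨ sym (board-vertical wellTiled _ _
           (subst (_< n) (m∸n≡suc[m∸1+n] i+1<n) (mirror-< (<-trans (n<1+n i) i+1<n)))
           (mirror-< j<m)) ⟩
      bottomE (Tᵇ (n ∸ suc (suc i)) (m ∸ suc j))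
        ≡⟨ sym (topE-rot180 _) ⟩
      topE (rot180 (Tᵇ (n ∸ suc (suc i)) (m ∸ suc j)))
        ≡⟨ cong topE (sym (Bᵇ-region i+1<n j<m)) ⟩
      topE (Bᵇ (suc i) j) ∎
      where open ≡-Reasoning
    ... | yes j<m | no i+1≮n | yes i<n = begin
      bottomE (Bᵇ i j)
        ≡⟨ cong bottomE (Bᵇ-region i<n j<m) ⟩
      bottomE (rot180 (Tᵇ (n ∸ suc i) (m ∸ suc j)))
        ≡⟨ bottomE-rot180 _ ⟩
      topE (Tᵇ (n ∸ suc i) (m ∸ suc j))
        ≡⟨ cong (λ x → topE (Tᵇ x (m ∸ suc j))) (last-index i+1≮n i<n) ⟩
      topE (Tᵇ 0 (m ∸ suc j))
        ≡⟨ topE-T≡vertical j j<m ⟩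
      vertical (suc n) (suc j)
        ≡⟨ cong (λ x → vertical (suc x) (suc j)) (sym (≤-antisym i<n (≮⇒≥ i+1≮n))) ⟩
      vertical (suc (suc i)) (suc j)
        ≡⟨ sym (topE-rothe (suc (suc i)) (suc j) (s≤s z≤n)) ⟩
      topE (rotheᵇ (suc i) j)
        ≡⟨ cong topE (sym (Bᵇ-below (≮⇒≥ i+1≮n))) ⟩
      topE (Bᵇ (suc i) j) ∎
      where open ≡-Reasoning

    Bᵇ-left : ∀ i → leftE (Bᵇ i 0) ≡ false
    Bᵇ-left i with region? i 0
    ... | inj₁ (i<n , 0<m) =
      trans (cong leftE (Bᵇ-region i<n 0<m)) (trans (leftE-rot180 _) (Tᵇ-right (n ∸ suc i) (mirror-< i<n) 0<m))
    ... | inj₂ B≡ = trans (cong leftE B≡) (trans (leftE-rothe (suc i) 1 (s≤s z≤n))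
                                                 (<ᵇ-false (λ w<1 → <⇒≱ w<1 (positive (suc i) (s≤s z≤n)))))

    Bᵇ-top : ∀ j → topE (Bᵇ 0 j) ≡ false
    Bᵇ-top j with region? 0 j
    ... | inj₁ (0<n , j<m) =
      trans (cong topE (Bᵇ-region 0<n j<m)) (trans (topE-rot180 _) (Tᵇ-bottom (m ∸ suc j) (mirror-< j<m)))
    ... | inj₂ B≡ = trans (cong topE B≡) (topE-rothe 1 (suc j) (s≤s z≤n))

    Bᵇ-bottom : ∀ j → j < N → bottomE (Bᵇ (N ∸ 1) j) ≡ true
    Bᵇ-bottom j j<N with region? (N ∸ 1) j
    ... | inj₁ (N-1<n , j<m) = begin
      bottomE (Bᵇ (N ∸ 1) j)
        ≡⟨ cong bottomE (Bᵇ-region N-1<n j<m) ⟩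
      bottomE (rot180 (Tᵇ (n ∸ suc (N ∸ 1)) (m ∸ suc j)))
        ≡⟨ bottomE-rot180 _ ⟩
      topE (Tᵇ (n ∸ suc (N ∸ 1)) (m ∸ suc j))
        ≡⟨ cong (λ x → topE (Tᵇ x (m ∸ suc j))) (last-index N≮n N-1<n) ⟩
      topE (Tᵇ 0 (m ∸ suc j))
        ≡⟨ topE-T≡vertical j j<m ⟩
      vertical (suc n) (suc j)
        ≡⟨ cong (λ x → vertical (suc x) (suc j)) n≡N ⟩
      vertical (suc N) (suc j)
        ≡⟨ vertical-below-all (suc j) (s≤s z≤n) j<N ⟩
      true ∎
      where
      open ≡-Reasoning
      N≮n : suc (N ∸ 1) ≮ n
      N≮n = subst (_≮ n) (sym (suc[n∸1]≡n 1≤N)) (≤⇒≯ n≤N)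
      n≡N : n ≡ N
      n≡N = ≤-antisym n≤N (subst (_≤ n) (suc[n∸1]≡n 1≤N) N-1<n)
    ... | inj₂ B≡ = trans (cong bottomE B≡) (trans (bottomE-rothe (suc (N ∸ 1)) (suc j) (s≤s z≤n))
                    (trans (cong (λ x → vertical (suc x) (suc j)) (suc[n∸1]≡n 1≤N)) (vertical-below-all (suc j) (s≤s z≤n) j<N)))

    Bᵇ-right : ∀ i → i < N → rightE (Bᵇ i (N ∸ 1)) ≡ true
    Bᵇ-right i i<N with region? i (N ∸ 1)
    ... | inj₁ (i<n , N-1<m) = begin
      rightE (Bᵇ i (N ∸ 1))
        ≡⟨ cong rightE (Bᵇ-region i<n N-1<m) ⟩
      rightE (rot180 (Tᵇ (n ∸ suc i) (m ∸ suc (N ∸ 1))))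
        ≡⟨ rightE-rot180 _ ⟩
      leftE (Tᵇ (n ∸ suc i) (m ∸ suc (N ∸ 1)))
        ≡⟨ cong (λ x → leftE (Tᵇ (n ∸ suc i) x)) (last-index N≮m N-1<m) ⟩
      leftE (Tᵇ (n ∸ suc i) 0)
        ≡⟨ Tᵇ-left-mirror i i<n (≤-<-trans z≤n N-1<m) ⟩
      (w (suc i) <ᵇ suc m)
        ≡⟨ <ᵇ-true (s≤s (subst (w (suc i) ≤_) (sym m≡N) (w≤N (suc i) (s≤s z≤n) i<N))) ⟩
      true ∎
      where
      open ≡-Reasoning
      N≮m : suc (N ∸ 1) ≮ m
      N≮m = subst (_≮ m) (sym (suc[n∸1]≡n 1≤N)) (≤⇒≯ m≤N)
      m≡N : m ≡ N
      m≡N = ≤-antisym m≤N (subst (_≤ m) (suc[n∸1]≡n 1≤N) N-1<m)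
    ... | inj₂ B≡ = trans (cong rightE B≡) (trans (rightE-rothe (suc i) (suc (N ∸ 1)) (s≤s z≤n))
                    (<ᵇ-true (s≤s (subst (w (suc i) ≤_) (sym (suc[n∸1]≡n 1≤N)) (w≤N (suc i) (s≤s z≤n) i<N)))))

    OnHook : ℕ → ℕ → Pos → Set
    OnHook i j p = (proj₂ p ≡ j × i ≤ proj₁ p) ⊎ (proj₁ p ≡ i × j ≤ proj₂ p)

    OnRegionPipe : ℕ → ℕ → Pos → Set
    OnRegionPipe i j p = (proj₂ p ≡ j × n ≤ proj₁ p) ⊎ InBox n m p ⊎ (proj₁ p ≡ i × m ≤ proj₂ p)

    module HookPipe (k : ℕ) (1≤k : 1 ≤ k) (k≤N : k ≤ N) (outsideRegion : n < k ⊎ m < w k) where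

      rothe-on-hook : ∀ r j → k ∸ 1 ≤ r → w k ∸ 1 ≤ j → Bᵇ r j ≡ rotheᵇ r j
      rothe-on-hook r j k-1≤r c-1≤j = [ below , beside ]′ outsideRegion
        where
        below : n < k → Bᵇ r j ≡ rotheᵇ r j
        below n<k = Bᵇ-below (≤-trans (<⇒≤pred n<k) k-1≤r)
        beside : m < w k → Bᵇ r j ≡ rotheᵇ r j
        beside m<c = Bᵇ-beside (≤-trans (<⇒≤pred m<c) c-1≤j)

      k-1<N : k ∸ 1 < N
      k-1<N = ≤-trans (n∸1<n 1≤k) k≤N

      c-1<N : w k ∸ 1 < N
      c-1<N = ≤-trans (n∸1<n (positive k 1≤k)) (w≤N k 1≤k k≤N)

      path : List Pos
      path = upPath (w k ∸ 1) (k ∸ 1) (N ∸ suc (k ∸ 1)) ++ rightPath (k ∸ 1) (w k ∸ 1) (N ∸ (w k ∸ 1))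

      walk : Walk Bᵇ N (at (N ∸ 1) (w k ∸ 1) up) (outRight (k ∸ 1)) path
      walk = walk-++ (walk-up-rothe Bᵇ k (k ∸ 1) 1≤k ≤-refl k-1<N (λ r k-1<r _ → rothe-on-hook r _ (<⇒≤ k-1<r) ≤-refl))
                     (walk-right-rothe Bᵇ k (w k ∸ 1) up 1≤k ≤-refl c-1<N turn
                        (λ c c-1<c _ → rothe-on-hook (k ∸ 1) c ≤-refl (<⇒≤ c-1<c)))
        where
        turn : transit (Bᵇ (k ∸ 1) (w k ∸ 1)) up ≡ just rightward
        turn rewrite rothe-on-hook (k ∸ 1) (w k ∸ 1) ≤-refl ≤-refl | rotheᵇ-corner k 1≤k = refl

      shape : ∀ {p} → p ∈ path → OnHook (k ∸ 1) (w k ∸ 1) p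
      shape p∈ with ++⁻ (upPath (w k ∸ 1) (k ∸ 1) (N ∸ suc (k ∸ 1))) p∈
      ... | inj₁ p∈up    = inj₁ (map₂ <⇒≤ (∈-upPath _ _ _ p∈up))
      ... | inj₂ p∈right = inj₂ (∈-rightPath _ _ _ p∈right)

    -- Inside the region the pipe of w k is the rotated pipe of T entering row n + 1 - k.
    module RegionPipe (k : ℕ) (1≤k : 1 ≤ k) (k≤n : k ≤ n) (c≤m : w k ≤ m) where

      a : ℕ
      a = suc n ∸ k

      1≤a : 1 ≤ a
      1≤a = proj₁ (reverse-index k 1≤k k≤n)

      a≤n : a ≤ n
      a≤n = proj₂ (reverse-index k 1≤k k≤n)

      pos : 0 < α a
      pos = small⇒positive k 1≤k k≤n c≤m

      0<m : 0 < m
      0<m = ≤-trans (positive k 1≤k) c≤m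

      c-1<m : w k ∸ 1 < m
      c-1<m = ≤-trans (n∸1<n (positive k 1≤k)) c≤m

      walk-Tₐ : Walk Tᵇ m (at (a ∸ 1) 0 rightward) (outTop (α a ∸ 1)) (pathT a)
      walk-Tₐ = walk-T a 1≤a a≤n pos

      pathT-inside : All (InBox n m) (pathT a)
      pathT-inside = walk-inside walk-Tₐ (≤-trans (n∸1<n 1≤a) a≤n , 0<m)

      inRegion : List Pos
      inRegion = reverse (map (rotate n m) (pathT a))

      rotState-top : RotT.rotState (outTop (α a ∸ 1)) ≡ at (n ∸ 1) (w k ∸ 1) up
      rotState-top = cong (λ x → at (n ∸ 1) x up) (begin
        m ∸ suc (α a ∸ 1)    ≡⟨ cong (m ∸_) (suc[n∸1]≡n pos) ⟩
        m ∸ α a              ≡⟨ sym (pred[m∸n]≡m∸[1+n] (suc m) (α a)) ⟩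
        suc m ∸ α a ∸ 1      ≡⟨ cong (_∸ 1) (sym (w-head-positive k 1≤k k≤n pos)) ⟩
        w k ∸ 1              ∎)
        where open ≡-Reasoning

      rotState-start : RotT.rotState (at (a ∸ 1) 0 rightward) ≡ outRight (k ∸ 1)
      rotState-start = trans (leave-rightward-edge m (n ∸ suc (a ∸ 1)) (m ∸ 1) (<-irrefl (suc[n∸1]≡n 0<m)))
                             (cong outRight (trans (cong (n ∸_) (suc[n∸1]≡n 1≤a)) (n∸[1+n∸k]≡k∸1 1≤k k≤n)))

      walk-region : Walk Bᵇ m (at (n ∸ 1) (w k ∸ 1) up) (outRight (k ∸ 1)) inRegion
      walk-region = subst₂ (λ s e → Walk Bᵇ m s e inRegion) rotState-top rotState-start
                      (RotT.walk-reversed walk-Tₐ (≤-trans (n∸1<n 1≤a) a≤n , 0<m))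

      inRegion-inside : All (InBox n m) inRegion
      inRegion-inside = walk-inside walk-region (n∸1<n 1≤n , c-1<m)

      below : List Pos
      below = upPath (w k ∸ 1) (n ∸ 1) (N ∸ suc (n ∸ 1))

      beside : List Pos
      beside = rightPath (k ∸ 1) m (N ∸ m)

      walk-beside : Walk Bᵇ N (widen m N (outRight (k ∸ 1))) (outRight (k ∸ 1)) beside
      walk-beside with m <? N
      ... | yes m<N rewrite <ᵇ-true m<N =
        walk-right-rothe Bᵇ k m rightward 1≤k (≤-trans (<⇒≤ c-1<m) ≤-refl) m<N (rothe-row m ≤-refl)
          (λ c m<c _ → Bᵇ-beside (<⇒≤ m<c))
        where
        rothe-row : ∀ c → m ≤ c → transit (Bᵇ (k ∸ 1) c) rightward ≡ just rightward
        rothe-row c m≤c rewrite Bᵇ-beside {k ∸ 1} m≤c = rotheᵇ-row k c 1≤k (<-≤-trans c-1<m m≤c)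
      ... | no m≮N rewrite <ᵇ-false m≮N =
        subst (λ x → Walk Bᵇ N (outRight (k ∸ 1)) (outRight (k ∸ 1)) (rightPath (k ∸ 1) m x))
              (sym (m≤n⇒m∸n≡0 (≮⇒≥ m≮N))) done

      path : List Pos
      path = below ++ inRegion ++ beside

      walk : Walk Bᵇ N (at (N ∸ 1) (w k ∸ 1) up) (outRight (k ∸ 1)) path
      walk = walk-++ (walk-up-rothe Bᵇ k (n ∸ 1) 1≤k (pred-mono-≤ k≤n) (≤-trans (n∸1<n 1≤n) n≤N)
                                    (λ r n-1<r _ → Bᵇ-below (subst (_≤ r) (suc[n∸1]≡n 1≤n) n-1<r)))
                     (walk-++ (Widening.walk-widen Bᵇ m N m≤N walk-region c-1<m (right _)) walk-beside)

      shape : ∀ {p} → p ∈ path → OnRegionPipe (k ∸ 1) (w k ∸ 1) p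
      shape p∈ with ++⁻ below p∈
      ... | inj₁ p∈below with c≡ , n-1<r ← ∈-upPath _ _ _ p∈below = inj₁ (c≡ , subst (_≤ _) (suc[n∸1]≡n 1≤n) n-1<r)
      ... | inj₂ p∈rest with ++⁻ inRegion p∈rest
      ...   | inj₁ p∈region = inj₂ (inj₁ (All.lookup inRegion-inside p∈region))
      ...   | inj₂ p∈beside = inj₂ (inj₂ (∈-rightPath _ _ _ p∈beside))

    data PipeShape (k : ℕ) (1≤k : 1 ≤ k) (P : List Pos) : Set where
      hook   : n ≤ k ∸ 1 ⊎ m ≤ w k ∸ 1 → (∀ {p} → p ∈ P → OnHook (k ∸ 1) (w k ∸ 1) p) → PipeShape k 1≤k P
      region : (k≤n : k ≤ n) (c≤m : w k ≤ m) → P ≡ RegionPipe.path k 1≤k k≤n c≤m → PipeShape k 1≤k P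

    pipe : ∀ k (1≤k : 1 ≤ k) → k ≤ N →
           Σ (List Pos) λ P → Walk Bᵇ N (at (N ∸ 1) (w k ∸ 1) up) (outRight (k ∸ 1)) P × PipeShape k 1≤k P
    pipe k 1≤k k≤N with k ≤? n | w k ≤? m
    ... | yes k≤n | yes c≤m = RegionPipe.path k 1≤k k≤n c≤m , RegionPipe.walk k 1≤k k≤n c≤m , region k≤n c≤m refl
    ... | no k≰n  | _       = path , walk , hook (inj₁ (<⇒≤pred (≰⇒> k≰n))) shape
      where open HookPipe k 1≤k k≤N (inj₁ (≰⇒> k≰n))
    ... | yes _   | no c≰m  = path , walk , hook (inj₂ (<⇒≤pred (≰⇒> c≰m))) shape
      where open HookPipe k 1≤k k≤N (inj₂ (≰⇒> c≰m))

    pipeFromBottom-B : ∀ k (1≤k : 1 ≤ k) (k≤N : k ≤ N) →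
                       pipeFromBottom B (w k) ≡ (proj₁ (pipe k 1≤k k≤N) , exitRight (k ∸ 1))
    pipeFromBottom-B k 1≤k k≤N = trace-walk B (N + N) (N ∸ 1) (w k ∸ 1) up walk-B (right _)
      (≤-trans (m≤m+n _ _) (≤-trans (walk-length walk-B) (+-mono-≤ (≤-reflexive (suc[n∸1]≡n 1≤N)) (m∸n≤m N (w k ∸ 1)))))
      where
      walk-B : Walk (board B) N (at (N ∸ 1) (w k ∸ 1) up) (outRight (k ∸ 1)) (proj₁ (pipe k 1≤k k≤N))
      walk-B = walk-cong (λ i j i<N j<N → sym (board-B i j i<N j<N)) (proj₁ (proj₂ (pipe k 1≤k k≤N)))
                 (n∸1<n 1≤N , ≤-trans (n∸1<n (positive k 1≤k)) (w≤N k 1≤k k≤N))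

    meet-once : ∀ {Pa Pb x₀} → Unique Pa → (∀ {p} → p ∈ Pa → p ∈ Pb → p ≡ x₀) → crossCount (isCrossAt B) Pa Pb ≤ 1
    meet-once {Pa} {Pb} {x₀} uniquePa meet = crossCount≤1 (isCrossAt B) Pa Pb x₀ uniquePa (λ a b _ → meet a b)

    hooks-meet-once : ∀ {ia ja ib jb x y} → ia < ib → ja ≢ jb → OnHook ia ja (x , y) → OnHook ib jb (x , y) →
                      (x , y) ≡ (ib , ja)
    hooks-meet-once ia<ib ja≢jb (inj₁ (refl , _)) (inj₁ (y≡jb , _))  = ⊥-elim (ja≢jb y≡jb)
    hooks-meet-once ia<ib ja≢jb (inj₁ (refl , _)) (inj₂ (refl , _))  = refl
    hooks-meet-once ia<ib ja≢jb (inj₂ (refl , _)) (inj₁ (_ , ib≤x))  = ⊥-elim (<⇒≱ ia<ib ib≤x)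
    hooks-meet-once ia<ib ja≢jb (inj₂ (refl , _)) (inj₂ (x≡ib , _))  = ⊥-elim (<⇒≢ ia<ib x≡ib)

    region-hook-meet-below : ∀ {ia ja ib jb x y} → ia < n → n ≤ ib → ja ≢ jb → ia ≢ ib →
                             OnRegionPipe ia ja (x , y) → OnHook ib jb (x , y) → (x , y) ≡ (ib , ja)
    region-hook-meet-below _ _ ja≢jb _ (inj₁ (refl , _)) (inj₁ (y≡jb , _)) = ⊥-elim (ja≢jb y≡jb)
    region-hook-meet-below _ _ _     _ (inj₁ (refl , _)) (inj₂ (refl , _)) = refl
    region-hook-meet-below _ n≤ib _ _ (inj₂ (inj₁ (x<n , _))) (inj₁ (_ , ib≤x)) = ⊥-elim (<⇒≱ x<n (≤-trans n≤ib ib≤x))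
    region-hook-meet-below _ n≤ib _ _ (inj₂ (inj₁ (x<n , _))) (inj₂ (refl , _)) = ⊥-elim (<⇒≱ x<n n≤ib)
    region-hook-meet-below ia<n n≤ib _ _ (inj₂ (inj₂ (refl , _))) (inj₁ (_ , ib≤x)) = ⊥-elim (<⇒≱ ia<n (≤-trans n≤ib ib≤x))
    region-hook-meet-below _ _ _ ia≢ib (inj₂ (inj₂ (refl , _))) (inj₂ (x≡ib , _)) = ⊥-elim (ia≢ib x≡ib)

    region-hook-meet-beside : ∀ {ia ja ib jb x y} → ja < m → m ≤ jb → ja ≢ jb → ia ≢ ib →
                              OnRegionPipe ia ja (x , y) → OnHook ib jb (x , y) → (x , y) ≡ (ia , jb)
    region-hook-meet-beside _ _ ja≢jb _ (inj₁ (refl , _)) (inj₁ (y≡jb , _)) = ⊥-elim (ja≢jb y≡jb)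
    region-hook-meet-beside ja<m m≤jb _ _ (inj₁ (refl , _)) (inj₂ (_ , jb≤y)) = ⊥-elim (<⇒≱ ja<m (≤-trans m≤jb jb≤y))
    region-hook-meet-beside _ m≤jb _ _ (inj₂ (inj₁ (_ , y<m))) (inj₁ (refl , _)) = ⊥-elim (<⇒≱ y<m m≤jb)
    region-hook-meet-beside _ m≤jb _ _ (inj₂ (inj₁ (_ , y<m))) (inj₂ (_ , jb≤y)) = ⊥-elim (<⇒≱ y<m (≤-trans m≤jb jb≤y))
    region-hook-meet-beside _ _ _ _     (inj₂ (inj₂ (refl , _))) (inj₁ (refl , _)) = refl
    region-hook-meet-beside _ _ _ ia≢ib (inj₂ (inj₂ (refl , _))) (inj₂ (x≡ib , _)) = ⊥-elim (ia≢ib x≡ib)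

    region-pipes-meet-inside : ∀ {ia ja ib jb p} → ia < n → ib < n → ja ≢ jb → ia ≢ ib →
                               OnRegionPipe ia ja p → OnRegionPipe ib jb p → InBox n m p
    region-pipes-meet-inside _ _ ja≢jb _ (inj₁ (refl , _)) (inj₁ (y≡jb , _)) = ⊥-elim (ja≢jb y≡jb)
    region-pipes-meet-inside _ _ _ _ (inj₁ _) (inj₂ (inj₁ inBox)) = inBox
    region-pipes-meet-inside _ ib<n _ _ (inj₁ (_ , n≤x)) (inj₂ (inj₂ (x≡ib , _))) = ⊥-elim (<⇒≱ ib<n (subst (n ≤_) x≡ib n≤x))
    region-pipes-meet-inside _ _ _ _ (inj₂ (inj₁ inBox)) _ = inBox
    region-pipes-meet-inside ia<n _ _ _ (inj₂ (inj₂ (x≡ia , _))) (inj₁ (_ , n≤x)) = ⊥-elim (<⇒≱ ia<n (subst (n ≤_) x≡ia n≤x))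
    region-pipes-meet-inside _ _ _ _ (inj₂ (inj₂ _)) (inj₂ (inj₁ inBox)) = inBox
    region-pipes-meet-inside _ _ _ ia≢ib (inj₂ (inj₂ (x≡ia , _))) (inj₂ (inj₂ (x≡ib , _))) = ⊥-elim (ia≢ib (trans (sym x≡ia) x≡ib))

    crossB : Pos → Bool
    crossB p = isCross (Bᵇ (proj₁ p) (proj₂ p))

    crossT : Pos → Bool
    crossT p = isCross (Tᵇ (proj₁ p) (proj₂ p))

    crossB-rotate : ∀ p → InBox n m p → crossB (rotate n m p) ≡ crossT p
    crossB-rotate (i , j) (i<n , j<m) =
      trans (cong isCross (Bᵇ-region (mirror-< i<n) (mirror-< j<m)))
            (trans (isCross-rot180 _) (cong₂ (λ x y → isCross (Tᵇ x y)) (mirror-involutive i<n) (mirror-involutive j<m)))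

    -- Outside the region two such pipes run in distinct columns below it and distinct rows beside it,
    -- so they can only cross inside it, where they are the rotated pipes of T.
    module RegionPipePair (ka kb : ℕ) (1≤ka : 1 ≤ ka) (1≤kb : 1 ≤ kb) (ka≤n : ka ≤ n) (kb≤n : kb ≤ n)
                          (ca≤m : w ka ≤ m) (cb≤m : w kb ≤ m) (ka≢kb : ka ≢ kb) where

      module A  = RegionPipe ka 1≤ka ka≤n ca≤m
      module B′ = RegionPipe kb 1≤kb kb≤n cb≤m

      a≢ : A.a ≢ B′.a
      a≢ eq = ka≢kb (∸-cancelˡ-≡ (≤-trans ka≤n (n≤1+n n)) (≤-trans kb≤n (n≤1+n n)) eq)

      meet-inside : ∀ {p} → p ∈ A.path → p ∈ B′.path → InBox n m p
      meet-inside p∈A p∈B = region-pipes-meet-inside (≤-trans (n∸1<n 1≤ka) ka≤n) (≤-trans (n∸1<n 1≤kb) kb≤n)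
        (elbow-columns-distinct 1≤ka 1≤kb ka≢kb)
        (≢-pred 1≤ka 1≤kb ka≢kb) (A.shape p∈A) (B′.shape p∈B)

      below-unshared : All (λ p → ¬ p ∈ B′.path) A.below
      below-unshared = All.tabulate λ p∈ p∈B →
        <⇒≱ (proj₁ (meet-inside (++⁺ˡ p∈) p∈B)) (subst (_≤ _) (suc[n∸1]≡n 1≤n) (proj₂ (∈-upPath _ _ _ p∈)))

      beside-unshared : All (λ p → ¬ p ∈ B′.path) A.beside
      beside-unshared = All.tabulate λ p∈ p∈B →
        <⇒≱ (proj₂ (meet-inside (++⁺ʳ A.below (++⁺ʳ A.inRegion p∈)) p∈B)) (proj₂ (∈-rightPath _ _ _ p∈))

      shared-in-region : ∀ {p} → p ∈ A.inRegion → counted (isCrossAt B) B′.path p ≡ true →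
                         counted crossB B′.inRegion p ≡ true
      shared-in-region {i , j} p∈ counted≡ with All.lookup A.inRegion-inside p∈
      ... | i<n , j<m = ∧-intro (trans (sym crossB≡) (∧-conicalˡ _ _ counted≡))
                                (∈⇒memberᵇ _ _ (in-region (memberᵇ⇒∈ _ _ (∧-conicalʳ _ _ counted≡))))
        where
        crossB≡ : isCrossAt B (i , j) ≡ crossB (i , j)
        crossB≡ = trans (isCrossAt-board B i j) (cong isCross (board-B i j (≤-trans i<n n≤N) (≤-trans j<m m≤N)))
        in-region : (i , j) ∈ B′.path → (i , j) ∈ B′.inRegion
        in-region q with ++⁻ B′.below q
        ... | inj₁ q∈below = ⊥-elim (<⇒≱ i<n (subst (_≤ i) (suc[n∸1]≡n 1≤n) (proj₂ (∈-upPath _ _ _ q∈below))))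
        ... | inj₂ q′ with ++⁻ B′.inRegion q′
        ...   | inj₁ q∈region = q∈region
        ...   | inj₂ q∈beside = ⊥-elim (<⇒≱ j<m (proj₂ (∈-rightPath _ _ _ q∈beside)))

      cross-once : crossCount (isCrossAt B) A.path B′.path ≤ 1
      cross-once = begin
        crossCount (isCrossAt B) A.path B′.path
          ≡⟨ crossCount-middle (isCrossAt B) A.below A.inRegion A.beside B′.path
               (crossCount-disjoint _ _ _ below-unshared) (crossCount-disjoint _ _ _ beside-unshared) ⟩
        crossCount (isCrossAt B) A.inRegion B′.path
          ≤⟨ crossCount-mono _ _ _ _ _ (All.tabulate shared-in-region) ⟩
        crossCount crossB A.inRegion B′.inRegion
          ≡⟨ crossCount-reverse-map crossT crossB crossB-rotate (pathT A.a) (pathT B′.a) A.pathT-inside B′.pathT-inside ⟩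
        crossCount crossT (pathT A.a) (pathT B′.a)
          ≡⟨ crossCount-cong _ _ (pathT A.a) (pathT B′.a) (λ p → sym (isCrossAt-board T (proj₁ p) (proj₂ p))) ⟩
        crossCount (isCrossAt T) (pathT A.a) (pathT B′.a)
          ≡⟨ sym (crossings≡crossCount T (pipeFromLeft T A.a) (pipeFromLeft T B′.a)) ⟩
        crossings T (pipeFromLeft T A.a) (pipeFromLeft T B′.a)
          ≤⟨ reduced A.a B′.a A.1≤a A.a≤n B′.1≤a B′.a≤n a≢ A.pos B′.pos ⟩
        1 ∎
        where
        open ≤-Reasoning
        open CrossCountMap (InBox n m) (rotate n m) (rotate-injective n m)

    pipes-cross-once : ∀ ka kb (1≤ka : 1 ≤ ka) (1≤kb : 1 ≤ kb) → ka ≢ kb → ∀ Pa Pb → Unique Pa →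
                       PipeShape ka 1≤ka Pa → PipeShape kb 1≤kb Pb → crossCount (isCrossAt B) Pa Pb ≤ 1
    pipes-cross-once ka kb 1≤ka 1≤kb ka≢kb Pa Pb uniquePa (region ka≤n ca≤m refl) (region kb≤n cb≤m refl) =
      RegionPipePair.cross-once ka kb 1≤ka 1≤kb ka≤n kb≤n ca≤m cb≤m ka≢kb
    pipes-cross-once ka kb 1≤ka 1≤kb ka≢kb Pa Pb uniquePa (hook _ onA) (hook _ onB) with ka ∸ 1 <? kb ∸ 1
    ... | yes ia<ib = meet-once uniquePa λ {(x , y)} a b →
      hooks-meet-once ia<ib (elbow-columns-distinct 1≤ka 1≤kb ka≢kb) (onA a) (onB b)
    ... | no ia≮ib = meet-once uniquePa λ {(x , y)} a b →
      hooks-meet-once ib<ia (elbow-columns-distinct 1≤kb 1≤ka (≢-sym ka≢kb)) (onB b) (onA a)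
      where
      ib<ia : kb ∸ 1 < ka ∸ 1
      ib<ia = ≤∧≢⇒< (≮⇒≥ ia≮ib) (≢-sym (≢-pred 1≤ka 1≤kb ka≢kb))
    pipes-cross-once ka kb 1≤ka 1≤kb ka≢kb Pa Pb uniquePa (region ka≤n ca≤m refl) (hook (inj₁ n≤ib) onB) =
      meet-once uniquePa λ {(x , y)} a b → region-hook-meet-below (≤-trans (n∸1<n 1≤ka) ka≤n) n≤ib
        (elbow-columns-distinct 1≤ka 1≤kb ka≢kb)
        (≢-pred 1≤ka 1≤kb ka≢kb) (RegionPipe.shape ka 1≤ka ka≤n ca≤m a) (onB b)
    pipes-cross-once ka kb 1≤ka 1≤kb ka≢kb Pa Pb uniquePa (region ka≤n ca≤m refl) (hook (inj₂ m≤jb) onB) =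
      meet-once uniquePa λ {(x , y)} a b → region-hook-meet-beside (≤-trans (n∸1<n (positive ka 1≤ka)) ca≤m) m≤jb
        (elbow-columns-distinct 1≤ka 1≤kb ka≢kb)
        (≢-pred 1≤ka 1≤kb ka≢kb) (RegionPipe.shape ka 1≤ka ka≤n ca≤m a) (onB b)
    pipes-cross-once ka kb 1≤ka 1≤kb ka≢kb Pa Pb uniquePa (hook (inj₁ n≤ia) onA) (region kb≤n cb≤m refl) =
      meet-once uniquePa λ {(x , y)} a b → region-hook-meet-below (≤-trans (n∸1<n 1≤kb) kb≤n) n≤ia
        (elbow-columns-distinct 1≤kb 1≤ka (≢-sym ka≢kb))
        (≢-pred 1≤kb 1≤ka (≢-sym ka≢kb)) (RegionPipe.shape kb 1≤kb kb≤n cb≤m b) (onA a)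
    pipes-cross-once ka kb 1≤ka 1≤kb ka≢kb Pa Pb uniquePa (hook (inj₂ m≤ja) onA) (region kb≤n cb≤m refl) =
      meet-once uniquePa λ {(x , y)} a b → region-hook-meet-beside (≤-trans (n∸1<n (positive kb 1≤kb)) cb≤m) m≤ja
        (elbow-columns-distinct 1≤kb 1≤ka (≢-sym ka≢kb))
        (≢-pred 1≤kb 1≤ka (≢-sym ka≢kb)) (RegionPipe.shape kb 1≤kb kb≤n cb≤m b) (onA a)

    isBPD : IsBPD N w B
    isBPD = record
      { wellTiled   = record
          { horizontal = λ a b b′ e →
              subst (λ x → rightE (B a b) ≡ leftE (Bᵇ (toℕ a) x)) e (Bᵇ-horizontal (toℕ a) (toℕ b))
          ; vertical   = λ a a′ b e →
              subst (λ x → bottomE (B a b) ≡ topE (Bᵇ x (toℕ b))) e (Bᵇ-vertical (toℕ a) (toℕ b))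
          }
      ; leftEmpty   = λ a b e → subst (λ x → leftE (Bᵇ (toℕ a) x) ≡ false) (sym e) (Bᵇ-left (toℕ a))
      ; topEmpty    = λ a b e → subst (λ x → topE (Bᵇ x (toℕ b)) ≡ false) (sym e) (Bᵇ-top (toℕ b))
      ; bottomFull  = λ a b e →
          subst (λ x → bottomE (Bᵇ x (toℕ b)) ≡ true) (cong (_∸ 1) (sym e)) (Bᵇ-bottom (toℕ b) (toℕ<n b))
      ; rightFull   = λ a b e →
          subst (λ x → rightE (Bᵇ (toℕ a) x) ≡ true) (cong (_∸ 1) (sym e)) (Bᵇ-right (toℕ a) (toℕ<n a))
      ; pipes       = λ i 1≤i i≤N → cong proj₂ (pipeFromBottom-B i 1≤i i≤N)
      ; reduced     = reduced-B
      }
      where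
      reduced-B : ∀ a b → 1 ≤ a → a ≤ N → 1 ≤ b → b ≤ N → a ≢ b →
                  crossings B (pipeFromBottom B a) (pipeFromBottom B b) ≤ 1
      reduced-B a b 1≤a a≤N 1≤b b≤N a≢b
        with ka , 1≤ka , ka≤N , refl ← w-onto a 1≤a a≤N | kb , 1≤kb , kb≤N , refl ← w-onto b 1≤b b≤N
        rewrite crossings≡crossCount B (pipeFromBottom B (w ka)) (pipeFromBottom B (w kb))
              | pipeFromBottom-B ka 1≤ka ka≤N | pipeFromBottom-B kb 1≤kb kb≤N =
        pipes-cross-once ka kb 1≤ka 1≤kb (λ eq → a≢b (cong w eq)) _ _ (walk-unique (proj₁ (proj₂ (pipe ka 1≤ka ka≤N))))
                         (proj₂ (proj₂ (pipe ka 1≤ka ka≤N))) (proj₂ (proj₂ (pipe kb 1≤kb kb≤N)))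

    region-T : ∀ i j → T i j ≡ restrictRotate n≤N m≤N B i j
    region-T i j = sym (begin
      rot180 (Bᵇ (toℕ (inject≤ (opposite i) n≤N)) (toℕ (inject≤ (opposite j) m≤N)))
        ≡⟨ cong rot180 (cong₂ Bᵇ (trans (toℕ-inject≤ (opposite i) n≤N) (opposite-prop i))
                                 (trans (toℕ-inject≤ (opposite j) m≤N) (opposite-prop j))) ⟩
      rot180 (Bᵇ (n ∸ suc (toℕ i)) (m ∸ suc (toℕ j)))
        ≡⟨ cong rot180 (Bᵇ-region (mirror-< (toℕ<n i)) (mirror-< (toℕ<n j))) ⟩
      rot180 (rot180 (Tᵇ (n ∸ suc (n ∸ suc (toℕ i))) (m ∸ suc (m ∸ suc (toℕ j)))))
        ≡⟨ rot180-involutive _ ⟩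
      Tᵇ (n ∸ suc (n ∸ suc (toℕ i))) (m ∸ suc (m ∸ suc (toℕ j)))
        ≡⟨ cong₂ Tᵇ (mirror-involutive (toℕ<n i)) (mirror-involutive (toℕ<n j)) ⟩
      Tᵇ (toℕ i) (toℕ j)
        ≡⟨ board-toℕ T i j ⟩
      T i j ∎)
      where open ≡-Reasoning

  -- Bumpless pipedreams of w outside the region

  module RotheOutside (B : Grid N N) (bpd : IsBPD N w B) where

    open IsBPD bpd

    Bᵇ : Board
    Bᵇ = board B

    Bᵇ-horizontal : ∀ i j → i < N → suc j < N → rightE (Bᵇ i j) ≡ leftE (Bᵇ i (suc j))
    Bᵇ-horizontal = board-horizontal wellTiled

    Bᵇ-vertical : ∀ i j → suc i < N → j < N → bottomE (Bᵇ i j) ≡ topE (Bᵇ (suc i) j)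
    Bᵇ-vertical = board-vertical wellTiled

    Bᵇ-left : ∀ i → i < N → leftE (Bᵇ i 0) ≡ false
    Bᵇ-left i i<N rewrite board-inside B i 0 i<N 1≤N = leftEmpty (fromℕ< i<N) (fromℕ< 1≤N) (toℕ-fromℕ< 1≤N)

    Bᵇ-top : ∀ j → j < N → topE (Bᵇ 0 j) ≡ false
    Bᵇ-top j j<N rewrite board-inside B 0 j 1≤N j<N = topEmpty (fromℕ< 1≤N) (fromℕ< j<N) (toℕ-fromℕ< 1≤N)

    Bᵇ-bottom : ∀ j → j < N → bottomE (Bᵇ (N ∸ 1) j) ≡ true
    Bᵇ-bottom j j<N rewrite board-inside B (N ∸ 1) j (n∸1<n 1≤N) j<N =
      bottomFull _ _ (trans (cong suc (toℕ-fromℕ< (n∸1<n 1≤N))) (suc[n∸1]≡n 1≤N))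

    Bᵇ-right : ∀ i → i < N → rightE (Bᵇ i (N ∸ 1)) ≡ true
    Bᵇ-right i i<N rewrite board-inside B i (N ∸ 1) i<N (n∸1<n 1≤N) =
      rightFull _ _ (trans (cong suc (toℕ-fromℕ< (n∸1<n 1≤N))) (suc[n∸1]≡n 1≤N))

    pathB : ℕ → List Pos
    pathB k = proj₁ (pipeFromBottom B (w k))

    walk-B : ∀ k → 1 ≤ k → k ≤ N → Walk Bᵇ N (at (N ∸ 1) (w k ∸ 1) up) (outRight (k ∸ 1)) (pathB k)
    walk-B k 1≤k k≤N = view-outRight (trace-view B (N + N) (N ∸ 1) (w k ∸ 1) up) (pipes k 1≤k k≤N)

    RotheRow : ℕ → Set
    RotheRow i = ∀ j → j < N → Bᵇ i j ≡ rotheᵇ i j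

    -- The pipe of w (i + 1) rises through
    -- them in column w (i + 1) and must turn right in row i (it cannot come back down), so row i
    -- carries vertical lines to the left of the elbow and the Rothe tiles to the right of it.
    module RowStep (i : ℕ) (n≤i : n ≤ i) (i<N : i < N) (below : ∀ r → i < r → r < N → RotheRow r) where

      c : ℕ
      c = w (suc i)

      1≤c : 1 ≤ c
      1≤c = positive (suc i) (s≤s z≤n)

      c≤N : c ≤ N
      c≤N = w≤N (suc i) (s≤s z≤n) i<N

      j₀ : ℕ
      j₀ = c ∸ 1

      bottom-edge : ∀ j → j < N → bottomE (Bᵇ i j) ≡ vertical (suc (suc i)) (suc j)
      bottom-edge j j<N with suc i <? N
      ... | yes i+1<N = trans (Bᵇ-vertical i j i+1<N j<N)
                              (trans (cong topE (below (suc i) (n<1+n i) i+1<N j j<N)) (topE-rothe (suc (suc i)) (suc j) (s≤s z≤n)))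
      ... | no i+1≮N = trans (cong (λ x → bottomE (Bᵇ x j)) (cong (_∸ 1) i+1≡N))
                             (trans (Bᵇ-bottom j j<N) (sym (subst (λ x → vertical (suc x) (suc j) ≡ true) (sym i+1≡N)
                                                                  (vertical-below-all (suc j) (s≤s z≤n) j<N))))
        where
        i+1≡N : suc i ≡ N
        i+1≡N = ≤-antisym i<N (≮⇒≥ i+1≮N)

      bottom-edge-right : ∀ j → j₀ < j → j < N → bottomE (Bᵇ i j) ≡ vertical (suc i) (suc j)
      bottom-edge-right j j₀<j j<N =
        trans (bottom-edge j j<N) (trans (cong (vertical (suc i) (suc j) ∨_) (≡ᵇ-false c≢)) (∨-identityʳ _))
        where
        c≢ : c ≢ suc j
        c≢ eq = <-irrefl eq (subst (_< suc j) (suc[n∸1]≡n 1≤c) (s≤s j₀<j))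

      walk-from-row : Σ (List Pos) λ ps → Walk Bᵇ N (at i j₀ up) (outRight i) ps
      walk-from-row with ps , walk , _ ← walk-split
                           (walk-up-rothe Bᵇ (suc i) i (s≤s z≤n) ≤-refl i<N (λ r i<r r<N → below r i<r r<N j₀ (≤-trans (n∸1<n 1≤c) c≤N)))
                           (walk-B (suc i) (s≤s z≤n) i<N) (right i) = ps , walk

      elbow-at-j₀ : Σ (List Pos) λ ps → Bᵇ i j₀ ≡ rElbow × Walk Bᵇ N (leave N i j₀ rightward) (outRight i) ps
      elbow-at-j₀ with _ , more st rest ← walk-from-row with step-inverse Bᵇ N i j₀ up st
      ... | up        , _    , refl = ⊥-elim (<-irrefl refl (stepUp-exits-above rest))
      ... | rightward , turn , refl = _ , transit-up-rightward (Bᵇ i j₀) turn , rest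

      right-of-elbow : ∀ j {ps} → j₀ < j → Walk Bᵇ N (at i j rightward) (outRight i) ps →
                       ∀ j′ → j ≤ j′ → j′ < N → Bᵇ i j′ ≡ rotheᵇ i j′
      right-of-elbow j j₀<j (more st rest) j′ j≤j′ j′<N with step-inverse Bᵇ N i j rightward st
      ... | up , _ , refl = ⊥-elim (<-irrefl refl (stepUp-exits-above rest))
      ... | rightward , straight , refl with j′ ≟ j
      ...   | yes refl = [ from-cross , from-hline ]′ (transit-rightward-rightward (Bᵇ i j′) straight)
        where
        w<c : w (suc i) < suc j′
        w<c = subst (_< suc j′) (suc[n∸1]≡n 1≤c) (s≤s j₀<j)
        from-cross : Bᵇ i j′ ≡ cross → Bᵇ i j′ ≡ rotheᵇ i j′
        from-cross B≡ = trans B≡ (sym (rothe-cross (suc i) (suc j′) w<c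
                          (trans (sym (bottom-edge-right j′ j₀<j j′<N)) (cong bottomE B≡))))
        from-hline : Bᵇ i j′ ≡ hline → Bᵇ i j′ ≡ rotheᵇ i j′
        from-hline B≡ = trans B≡ (sym (rothe-hline (suc i) (suc j′) w<c
                          (trans (sym (bottom-edge-right j′ j₀<j j′<N)) (cong bottomE B≡))))
      ...   | no j′≢j with suc j <? N
      ...     | yes fits rewrite leave-rightward-inside N i j fits =
                right-of-elbow (suc j) (<-trans j₀<j (n<1+n j)) rest j′ (≤∧≢⇒< j≤j′ (λ eq → j′≢j (sym eq))) j′<N
      ...     | no edge = ⊥-elim (edge (≤-<-trans (≤∧≢⇒< j≤j′ (λ eq → j′≢j (sym eq))) j′<N))

      -- Left of the elbow every column is taken by a pipe turning above row i + 1: one turning below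
      -- would, w being increasing on the tail, have a larger value.
      vertical-left : ∀ j → suc j < c → vertical (suc i) (suc j) ≡ true
      vertical-left j j+1<c with i′ , 1≤i′ , i′≤N , wi′≡ ← w-onto (suc j) (s≤s z≤n) (≤-trans (<⇒≤ j+1<c) c≤N) with i′ <? suc i
      ... | yes i′<i+1 = vertical-complete (suc i) (suc j) i′ 1≤i′ i′<i+1 wi′≡
      ... | no i′≮i+1 with i′ ≟ suc i
      ...   | yes refl = ⊥-elim (<-irrefl (sym wi′≡) j+1<c)
      ...   | no i′≢ = ⊥-elim (<-asym j+1<c (subst (c <_) wi′≡ (increasingTail (suc i) i′ (s≤s n≤i)
                                                                  (≤∧≢⇒< (≮⇒≥ i′≮i+1) (λ eq → i′≢ (sym eq))))))

      bottom-edge-left : ∀ j → suc j < c → bottomE (Bᵇ i j) ≡ true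
      bottom-edge-left j j+1<c = trans (bottom-edge j (≤-trans (<⇒≤ j+1<c) c≤N))
                                       (cong (_∨ elbowAt (suc i) (suc j)) (vertical-left j j+1<c))

      -- An elbow left of j₀ would start a run of crossings ending in the elbow at j₀, whose left edge is empty.
      no-run-into-elbow : ∀ d j → j + d ≡ j₀ → leftE (Bᵇ i j) ≡ true → ⊥
      no-run-into-elbow zero j j≡j₀ left≡ =
        true≢false (trans (sym left≡)
          (cong leftE (trans (cong (Bᵇ i) (trans (sym (+-identityʳ j)) j≡j₀)) (proj₁ (proj₂ elbow-at-j₀)))))
      no-run-into-elbow (suc d) j j+d≡j₀ left≡ =
        no-run-into-elbow d (suc j) (trans (sym (+-suc j d)) j+d≡j₀)
          (trans (sym (Bᵇ-horizontal i j i<N (≤-trans j+1<c c≤N)))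
                 (cong rightE (leftE∧bottomE (Bᵇ i j) left≡ (bottom-edge-left j j+1<c))))
        where
        j+1<c : suc j < c
        j+1<c = subst (suc j <_) (suc[n∸1]≡n 1≤c) (s≤s (subst (suc j ≤_) (trans (sym (+-suc j d)) j+d≡j₀) (m≤m+n (suc j) d)))

      left-empty : ∀ j → suc j < c → leftE (Bᵇ i j) ≡ false
      vline-left : ∀ j → suc j < c → Bᵇ i j ≡ vline

      left-empty zero    _     = Bᵇ-left i i<N
      left-empty (suc j) j+2<c = trans (sym (Bᵇ-horizontal i j i<N (≤-trans (<⇒≤ j+2<c) c≤N)))
                                       (cong rightE (vline-left j (<-trans (n<1+n (suc j)) j+2<c)))

      vline-left j j+1<c =
        [ elbow-impossible , (λ v → v) ]′ (¬leftE∧bottomE (Bᵇ i j) (left-empty j j+1<c) (bottom-edge-left j j+1<c))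
        where
        elbow-impossible : Bᵇ i j ≡ rElbow → Bᵇ i j ≡ vline
        elbow-impossible B≡ = ⊥-elim (no-run-into-elbow (j₀ ∸ suc j) (suc j)
                                (m+[n∸m]≡n (≤-pred (subst (suc (suc j) ≤_) (sym (suc[n∸1]≡n 1≤c)) j+1<c)))
                                (trans (sym (Bᵇ-horizontal i j i<N (≤-trans j+1<c c≤N))) (cong rightE B≡)))

      rotheRow : RotheRow i
      rotheRow j j<N with <-cmp j j₀
      ... | tri< j<j₀ _ _ = trans (vline-left j j+1<c) (sym (rothe-vline (suc i) (suc j) j+1<c (vertical-left j j+1<c)))
        where
        j+1<c : suc j < c
        j+1<c = subst (suc j <_) (suc[n∸1]≡n 1≤c) (s≤s j<j₀)
      ... | tri≈ _ refl _ = trans (proj₁ (proj₂ elbow-at-j₀)) (sym (rotheᵇ-corner (suc i) (s≤s z≤n)))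
      ... | tri> _ _ j₀<j with suc j₀ <? N
      ...   | yes fits = right-of-elbow (suc j₀) (n<1+n j₀)
                           (subst (λ s → Walk Bᵇ N s (outRight i) (proj₁ elbow-at-j₀)) (leave-rightward-inside N i j₀ fits)
                                  (proj₂ (proj₂ elbow-at-j₀)))
                           j j₀<j j<N
      ...   | no edge  = ⊥-elim (edge (≤-<-trans j₀<j j<N))

    rotheRows : ∀ i → n ≤ i → i < N → RotheRow i
    rotheRows = downward-induction RotheRow n N RowStep.rotheRow

    RotheColumn : ℕ → Set
    RotheColumn j = ∀ i → i < N → Bᵇ i j ≡ rotheᵇ i j

    bottom-of-region : ∀ j → j < N → bottomE (Bᵇ (n ∸ 1) j) ≡ vertical (suc n) (suc j)
    bottom-of-region j j<N with n <? N
    ... | yes n<N = trans (Bᵇ-vertical (n ∸ 1) j (subst (_< N) (sym (suc[n∸1]≡n 1≤n)) n<N) j<N)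
                          (trans (cong (λ x → topE (Bᵇ x j)) (suc[n∸1]≡n 1≤n))
                                 (trans (cong topE (rotheRows n ≤-refl n<N j j<N)) (topE-rothe (suc n) (suc j) (s≤s z≤n))))
    ... | no n≮N = trans (cong (λ x → bottomE (Bᵇ (x ∸ 1) j)) n≡N)
                         (trans (Bᵇ-bottom j j<N) (sym (subst (λ x → vertical (suc x) (suc j) ≡ true) (sym n≡N)
                                                               (vertical-below-all (suc j) (s≤s z≤n) j<N))))
      where
      n≡N : n ≡ N
      n≡N = ≤-antisym n≤N (≮⇒≥ n≮N)

    rothe-row-exit : ∀ i j {e ps} → (∀ j′ → j ≤ j′ → j′ < N → Bᵇ i j′ ≡ rotheᵇ i j′) →
                     Walk Bᵇ N (at i j rightward) e ps → Exit e → e ≡ outRight i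
    rothe-row-exit i j rothe-right walk ex = walk-right-exit Bᵇ N i j no-up-turn walk ex
      where
      no-up-turn : ∀ j′ → j ≤ j′ → transit (Bᵇ i j′) rightward ≢ just up
      no-up-turn j′ j≤j′ with j′ <? N
      ... | yes j′<N rewrite rothe-right j′ j≤j′ j′<N = rothe-no-up-turn (suc i) (suc j′)
      ... | no j′≮N rewrite board-outside-column B i j′ j′≮N = λ ()

    exits-in-row : ∀ i j {e ps} → (∀ j′ → j < j′ → j′ < N → Bᵇ i j′ ≡ rotheᵇ i j′) →
                   Walk Bᵇ N (leave N i j rightward) e ps → Exit e → e ≡ outRight i
    exits-in-row i j rothe-right walk ex with suc j <? N
    ... | yes fits rewrite leave-rightward-inside N i j fits = rothe-row-exit i (suc j) rothe-right walk ex
    ... | no edge rewrite leave-rightward-edge N i j edge with refl , _ ← walk-from-exit walk (right i) = refl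

    module ColumnStep (j : ℕ) (m≤j : m ≤ j) (j<N : j < N) (rothe-right : ∀ j′ → j < j′ → j′ < N → RotheColumn j′) where

      c : ℕ
      c = suc j

      k : ℕ
      k = proj₁ (w-onto c (s≤s z≤n) j<N)

      1≤k : 1 ≤ k
      1≤k = proj₁ (proj₂ (w-onto c (s≤s z≤n) j<N))

      k≤N : k ≤ N
      k≤N = proj₁ (proj₂ (proj₂ (w-onto c (s≤s z≤n) j<N)))

      wk≡c : w k ≡ c
      wk≡c = proj₂ (proj₂ (proj₂ (w-onto c (s≤s z≤n) j<N)))

      right-edge : ∀ i → i < N → rightE (Bᵇ i j) ≡ (w (suc i) <ᵇ suc c)
      right-edge i i<N with suc j <? N
      ... | yes j+1<N = trans (Bᵇ-horizontal i j i<N j+1<N)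
                              (trans (cong leftE (rothe-right (suc j) (n<1+n j) j+1<N i i<N)) (leftE-rothe (suc i) (suc c) (s≤s z≤n)))
      ... | no j+1≮N = trans (cong (λ x → rightE (Bᵇ i (x ∸ 1))) c≡N)
                             (trans (Bᵇ-right i i<N) (sym (<ᵇ-true (s≤s (subst (w (suc i) ≤_) (sym c≡N) (w≤N (suc i) (s≤s z≤n) i<N))))))
        where
        c≡N : c ≡ N
        c≡N = ≤-antisym j<N (≮⇒≥ j+1≮N)

      vertical-none : ∀ r → r ≤ k → vertical r c ≡ false
      vertical-none r r≤k = vertical-false r c λ i 1≤i i<r wi≡c →
        <-irrefl (injective i k 1≤i 1≤k (trans wi≡c (sym wk≡c))) (<-≤-trans i<r r≤k)

      hline-rothe : ∀ i → Bᵇ i j ≡ hline → w (suc i) < c → suc i ≤ k → Bᵇ i j ≡ rotheᵇ i j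
      hline-rothe i B≡ w<c i<k = trans B≡ (sym (rothe-hline (suc i) c w<c (vertical-none (suc i) i<k)))

      -- A tile with an empty bottom edge whose row pipe passes column j on the left is a horizontal
      -- line, whose empty top edge propagates the argument upwards.
      hline-at : ∀ r → r < N → bottomE (Bᵇ r j) ≡ false → w (suc r) < c → Bᵇ r j ≡ hline
      hline-at r r<N bottom≡ w<c = rightE∧¬bottomE (Bᵇ r j) (trans (right-edge r r<N) (<ᵇ-true (m<n⇒m<1+n w<c))) bottom≡

      hline-column : ∀ r → r < N → bottomE (Bᵇ r j) ≡ false → (∀ i → i ≤ r → w (suc i) < c) →
                     ∀ i → i ≤ r → Bᵇ i j ≡ hline
      hline-column r r<N bottom≡ left i i≤r with i ≟ r
      ... | yes refl = hline-at r r<N bottom≡ (left r ≤-refl)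
      hline-column (suc r) r<N bottom≡ left i i≤r | no i≢r =
        hline-column r (<-trans (n<1+n r) r<N)
          (trans (Bᵇ-vertical r j r<N j<N) (cong topE (hline-at (suc r) r<N bottom≡ (left (suc r) ≤-refl))))
          (λ i′ i′≤r → left i′ (m≤n⇒m≤1+n i′≤r)) i (≤-pred (≤∧≢⇒< i≤r i≢r))
      hline-column zero r<N bottom≡ left i i≤r | no i≢r = ⊥-elim (i≢r (n≤0⇒n≡0 i≤r))

      -- k below the region: column j + 1 is free above row n + 1, and every pipe of rows 1, …, n passes left of it.
      module Far (n<k : n < k) where

        rotheColumn : ∀ i → i < n → Bᵇ i j ≡ rotheᵇ i j
        rotheColumn i i<n =
          hline-rothe i (hline-column (n ∸ 1) (≤-trans (n∸1<n 1≤n) n≤N) (trans (bottom-of-region j j<N) (vertical-none (suc n) n<k))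
                                      (λ i′ i′≤ → passes-left i′ (subst (suc i′ ≤_) (suc[n∸1]≡n 1≤n) (s≤s i′≤))) i
                                      (<⇒≤pred i<n))
                      (passes-left i i<n) (≤-trans i<n (<⇒≤ n<k))
          where
          passes-left : ∀ i → i < n → w (suc i) < c
          passes-left i i<n = large-tail-above-heads c k (s≤s m≤j) n<k wk≡c (suc i) (s≤s z≤n) i<n

      -- k in the region: the pipe of row k rises along column j + 1 and, the columns to its right
      -- being Rothe columns, cannot turn right before reaching row k.
      module Near (k≤n : k ≤ n) where

        column≡ : w k ∸ 1 ≡ j
        column≡ = cong (_∸ 1) wk≡c

        from-region : Σ (List Pos) λ ps → Walk Bᵇ N (at (n ∸ 1) j up) (outRight (k ∸ 1)) ps
        from-region
          with ps , walk , _ ← walk-split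
                 (walk-up-rothe Bᵇ k (n ∸ 1) 1≤k (pred-mono-≤ k≤n) (≤-trans (n∸1<n 1≤n) n≤N)
                    (λ r n-1<r r<N → rotheRows r (subst (_≤ r) (suc[n∸1]≡n 1≤n) n-1<r) r<N _
                                               (≤-trans (n∸1<n (positive k 1≤k)) (w≤N k 1≤k k≤N))))
                 (walk-B k 1≤k k≤N) (right _) =
          ps , subst (λ x → Walk Bᵇ N (at (n ∸ 1) x up) (outRight (k ∸ 1)) ps) column≡ walk

        Climb : ℕ → Set
        Climb i = transit (Bᵇ (k ∸ 1) j) up ≡ just rightward ×
                  (∀ i′ → k ∸ 1 < i′ → i′ ≤ i → transit (Bᵇ i′ j) up ≡ just up)

        climb : ∀ i {ps} → k ∸ 1 ≤ i → i < N → Walk Bᵇ N (at i j up) (outRight (k ∸ 1)) ps → Climb i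
        climb i k-1≤i i<N (more st rest) with step-inverse Bᵇ N i j up st
        climb i k-1≤i i<N (more st rest) | rightward , turn , refl
          with refl ← exits-in-row i j (λ j′ j<j′ j′<N → rothe-right j′ j<j′ j′<N i i<N) rest (right _) =
          turn , λ i′ k-1<i′ i′≤i → ⊥-elim (<⇒≱ k-1<i′ i′≤i)
        climb zero    k-1≤i i<N (more st rest) | up , _ , refl = ⊥-elim (n≮0 (stepUp-exits-above rest))
        climb (suc i) k-1≤i i<N (more st rest) | up , straight , refl
          with turn , straights ← climb i (≤-pred (stepUp-exits-above rest)) (<-trans (n<1+n i) i<N) rest = turn , straight-upto
          where
          straight-upto : ∀ i′ → k ∸ 1 < i′ → i′ ≤ suc i → transit (Bᵇ i′ j) up ≡ just up
          straight-upto i′ k-1<i′ i′≤ with i′ ≟ suc i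
          ... | yes refl = straight
          ... | no i′≢   = straights i′ k-1<i′ (≤-pred (≤∧≢⇒< i′≤ i′≢))

        climbed : Climb (n ∸ 1)
        climbed = climb (n ∸ 1) (pred-mono-≤ k≤n) (≤-trans (n∸1<n 1≤n) n≤N) (proj₂ from-region)

        elbow-tile : Bᵇ (k ∸ 1) j ≡ rElbow
        elbow-tile = transit-up-rightward _ (proj₁ climbed)

        upright-tile : ∀ i → k ∸ 1 < i → i < n → Bᵇ i j ≡ rotheᵇ i j
        upright-tile i k-1<i i<n = [ from-cross , from-vline ]′ (transit-up-up _ (proj₂ climbed i k-1<i (<⇒≤pred i<n)))
          where
          k≤i : k ≤ i
          k≤i = subst (_≤ i) (suc[n∸1]≡n 1≤k) k-1<i
          passing : vertical (suc i) c ≡ true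
          passing = vertical-complete (suc i) c k 1≤k (s≤s k≤i) wk≡c
          w≢c : w (suc i) ≢ c
          w≢c eq = <-irrefl (injective k (suc i) 1≤k (s≤s z≤n) (trans wk≡c (sym eq))) (s≤s k≤i)
          right≡ : rightE (Bᵇ i j) ≡ (w (suc i) <ᵇ suc c)
          right≡ = right-edge i (≤-trans i<n n≤N)
          from-cross : Bᵇ i j ≡ cross → Bᵇ i j ≡ rotheᵇ i j
          from-cross B≡ =
            trans B≡ (sym (rothe-cross (suc i) c (≤∧≢⇒< (≤-pred (<ᵇ-sound (trans (sym right≡) (cong rightE B≡)))) w≢c) passing))
          from-vline : Bᵇ i j ≡ vline → Bᵇ i j ≡ rotheᵇ i j
          from-vline B≡ =
            trans B≡ (sym (rothe-vline (suc i) c (≰⇒> (λ w≤c → <ᵇ-complete (trans (sym right≡) (cong rightE B≡)) (s≤s w≤c))) passing))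

        passes-left : ∀ i → suc i < k → w (suc i) < c
        passes-left i i+1<k with <-cmp (w (suc i)) c
        ... | tri< w<c _ _ = w<c
        ... | tri≈ _ w≡c _ = ⊥-elim (<-irrefl (injective (suc i) k (s≤s z≤n) 1≤k (trans w≡c (sym wk≡c))) i+1<k)
        ... | tri> _ _ c<w = ⊥-elim (<-asym i+1<k (large-heads-increasing k (suc i) 1≤k k≤n (s≤s z≤n) (≤-trans (<⇒≤ i+1<k) k≤n)
                                                     (subst (m <_) (sym wk≡c) (s≤s m≤j)) (subst (_< w (suc i)) (sym wk≡c) c<w)))

        hline-above : ∀ i → i < k ∸ 1 → Bᵇ i j ≡ rotheᵇ i j
        hline-above i i<k-1 =
          hline-rothe i (hline-column r r<N bottom≡ (λ i′ i′≤r → passes-left i′ (below-k i′ i′≤r)) i (<⇒≤pred i<k-1))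
                                          (passes-left i (below-k i (<⇒≤pred i<k-1))) (<⇒≤ (below-k i (<⇒≤pred i<k-1)))
          where
          r : ℕ
          r = k ∸ 1 ∸ 1
          r+1≡ : suc r ≡ k ∸ 1
          r+1≡ = suc[n∸1]≡n (≤-trans (s≤s z≤n) i<k-1)
          below-k : ∀ i′ → i′ ≤ r → suc i′ < k
          below-k i′ i′≤r = subst (suc i′ <_) (trans (cong suc r+1≡) (suc[n∸1]≡n 1≤k)) (s≤s (s≤s i′≤r))
          r<N : r < N
          r<N = <-trans (subst (r <_) r+1≡ (n<1+n r)) (≤-trans (n∸1<n 1≤k) k≤N)
          bottom≡ : bottomE (Bᵇ r j) ≡ false
          bottom≡ = trans (Bᵇ-vertical r j (subst (_< N) (sym r+1≡) (≤-trans (n∸1<n 1≤k) k≤N)) j<N)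
                          (trans (cong (λ x → topE (Bᵇ x j)) r+1≡) (cong topE elbow-tile))

        rotheColumn : ∀ i → i < n → Bᵇ i j ≡ rotheᵇ i j
        rotheColumn i i<n with <-cmp i (k ∸ 1)
        ... | tri< i<k-1 _ _ = hline-above i i<k-1
        ... | tri≈ _ refl _  = trans elbow-tile (sym (subst (λ x → rotheᵇ (k ∸ 1) x ≡ rElbow) column≡ (rotheᵇ-corner k 1≤k)))
        ... | tri> _ _ k-1<i = upright-tile i k-1<i i<n

      rotheColumn : ∀ i → i < n → Bᵇ i j ≡ rotheᵇ i j
      rotheColumn with k ≤? n
      ... | yes k≤n = Near.rotheColumn k≤n
      ... | no k≰n  = Far.rotheColumn (≰⇒> k≰n)

    rotheColumns : ∀ j → m ≤ j → j < N → RotheColumn j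
    rotheColumns = downward-induction RotheColumn m N column-step
      where
      column-step : ∀ j → m ≤ j → j < N → (∀ j′ → j < j′ → j′ < N → RotheColumn j′) → RotheColumn j
      column-step j m≤j j<N rothe-right i i<N with i <? n
      ... | yes i<n = ColumnStep.rotheColumn j m≤j j<N rothe-right i i<n
      ... | no i≮n  = rotheRows i (≮⇒≥ i≮n) i<N j j<N

    rothe-outside : ∀ i j → i < N → j < N → n ≤ i ⊎ m ≤ j → Bᵇ i j ≡ rotheᵇ i j
    rothe-outside i j i<N j<N (inj₁ n≤i) = rotheRows i n≤i i<N j j<N
    rothe-outside i j i<N j<N (inj₂ m≤j) = rotheColumns j m≤j j<N i i<N

  -- From a bumpless pipedream B of w back to T

  module ToLTBPD (B : Grid N N) (bpd : IsBPD N w B) (T : Grid n m)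
                 (T≡ : ∀ i j → T i j ≡ restrictRotate n≤N m≤N B i j) where

    open RotheOutside B bpd

    Tᵇ : Board
    Tᵇ = board T

    T-rotated : ∀ (a : Fin n) (b : Fin m) → T a b ≡ rot180 (Bᵇ (n ∸ suc (toℕ a)) (m ∸ suc (toℕ b)))
    T-rotated a b = trans (T≡ a b) (cong rot180 (trans (sym (board-toℕ B _ _))
                      (cong₂ Bᵇ (trans (toℕ-inject≤ (opposite a) n≤N) (opposite-prop a))
                                (trans (toℕ-inject≤ (opposite b) m≤N) (opposite-prop b)))))

    Tᵇ-rotated : ∀ i j → i < n → j < m → Tᵇ i j ≡ rot180 (Bᵇ (n ∸ suc i) (m ∸ suc j))
    Tᵇ-rotated i j i<n j<m =
      trans (board-inside T i j i<n j<m)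
            (trans (T-rotated _ _) (cong₂ (λ x y → rot180 (Bᵇ (n ∸ suc x) (m ∸ suc y))) (toℕ-fromℕ< i<n) (toℕ-fromℕ< j<m)))

    module RotB = Rot180 n m Bᵇ Tᵇ Tᵇ-rotated

    -- The pipe of T entering row a is, rotated, the part inside the region of the pipe of B that
    -- enters column w k for k = n + 1 - a.
    module PipeOfT (a : ℕ) (1≤a : 1 ≤ a) (a≤n : a ≤ n) (pos : 0 < α a) where

      k : ℕ
      k = suc n ∸ a

      1≤k : 1 ≤ k
      1≤k = proj₁ (reverse-index a 1≤a a≤n)

      k≤n : k ≤ n
      k≤n = proj₂ (reverse-index a 1≤a a≤n)

      k≤N : k ≤ N
      k≤N = ≤-trans k≤n n≤N

      wk≡ : w k ≡ suc m ∸ α a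
      wk≡ = trans (w-head-positive k 1≤k k≤n (subst (λ x → 0 < α x) (sym (reverse-involutive a≤n)) pos))
                  (cong (λ x → suc m ∸ α x) (reverse-involutive a≤n))

      c-1<m : w k ∸ 1 < m
      c-1<m = ≤-trans (n∸1<n (positive k 1≤k)) (subst (_≤ m) (sym wk≡) (suc[m]∸n≤m m pos))

      below : List Pos
      below = upPath (w k ∸ 1) (n ∸ 1) (N ∸ suc (n ∸ 1))

      walk-below : Walk Bᵇ N (at (N ∸ 1) (w k ∸ 1) up) (at (n ∸ 1) (w k ∸ 1) up) below
      walk-below = walk-up-rothe Bᵇ k (n ∸ 1) 1≤k (pred-mono-≤ k≤n) (≤-trans (n∸1<n 1≤n) n≤N)
                     (λ r n-1<r r<N → rothe-outside r _ r<N (≤-trans c-1<m m≤N) (inj₁ (subst (_≤ r) (suc[n∸1]≡n 1≤n) n-1<r)))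

      -- Leaving the region through its top would end the pipe there; leaving it through its right
      -- edge in row r, the pipe continues along the Rothe row r.
      exit-of-region : ∀ e {ps₁ ps₃} → Exit e → Walk Bᵇ m (at (n ∸ 1) (w k ∸ 1) up) e ps₁ →
                       Walk Bᵇ N (widen m N e) (outRight (k ∸ 1)) ps₃ → outRight (k ∸ 1) ≡ e
      exit-of-region (outTop x) _ _ rest with () , _ ← walk-from-exit rest (top x)
      exit-of-region (outRight r) _ inside rest with m <? N
      ... | no m≮N rewrite <ᵇ-false m≮N with refl , _ ← walk-from-exit rest (right r) = refl
      ... | yes m<N rewrite <ᵇ-true m<N =
        rothe-row-exit r m (λ j′ m≤j′ j′<N → rothe-outside r j′ r<N j′<N (inj₂ m≤j′)) rest (right _)
        where
        r<N : r < N
        r<N = ≤-<-trans (walk-row inside) (≤-trans (n∸1<n 1≤n) n≤N)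

      through-region : Σ (List Pos) λ ps₁ → Σ (List Pos) λ ps₃ →
                       Walk Bᵇ m (at (n ∸ 1) (w k ∸ 1) up) (outRight (k ∸ 1)) ps₁ × pathB k ≡ below ++ ps₁ ++ ps₃
      through-region
        with ps₂ , from-region , pathB≡ ← walk-split walk-below (walk-B k 1≤k k≤N) (right _)
        with e , ps₁ , ps₃ , ex , inside , rest , refl ← Widening.walk-restrict Bᵇ m N m≤N from-region c-1<m (right _)
        with refl ← exit-of-region e ex inside rest = ps₁ , ps₃ , inside , pathB≡

      inRegion : List Pos
      inRegion = proj₁ through-region

      walk-inRegion : Walk Bᵇ m (at (n ∸ 1) (w k ∸ 1) up) (outRight (k ∸ 1)) inRegion
      walk-inRegion = proj₁ (proj₂ (proj₂ through-region))

      pathB≡ : pathB k ≡ below ++ inRegion ++ proj₁ (proj₂ through-region)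
      pathB≡ = proj₂ (proj₂ (proj₂ through-region))

      inRegion-inside : All (InBox n m) inRegion
      inRegion-inside = walk-inside walk-inRegion (n∸1<n 1≤n , c-1<m)

      rotState-exit : RotB.rotState (outRight (k ∸ 1)) ≡ at (a ∸ 1) 0 rightward
      rotState-exit = cong (λ x → at x 0 rightward) (trans (cong (n ∸_) (suc[n∸1]≡n 1≤k)) (n∸[1+n∸k]≡k∸1 1≤a a≤n))

      rotState-entry : RotB.rotState (at (n ∸ 1) (w k ∸ 1) up) ≡ outTop (α a ∸ 1)
      rotState-entry rewrite suc[n∸1]≡n 1≤n | n∸n≡0 n =
        cong outTop (sym (∸-flip pos (α≤m a 1≤a a≤n) (trans (suc[n∸1]≡n (positive k 1≤k)) wk≡)))

      pathT : List Pos
      pathT = reverse (map (rotate n m) inRegion)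

      walk-T : Walk Tᵇ m (at (a ∸ 1) 0 rightward) (outTop (α a ∸ 1)) pathT
      walk-T = subst₂ (λ s e → Walk Tᵇ m s e pathT) rotState-exit rotState-entry
                      (RotB.walk-reversed walk-inRegion (n∸1<n 1≤n , c-1<m))

      pipeFromLeft-T : pipeFromLeft T a ≡ (pathT , exitTop (α a ∸ 1))
      pipeFromLeft-T = trace-walk T (n + m) (a ∸ 1) 0 rightward walk-T (top _)
        (≤-trans (m≤m+n _ _) (≤-trans (walk-length walk-T) (+-monoˡ-≤ m (subst (_≤ n) (sym (suc[n∸1]≡n 1≤a)) a≤n))))

    crossB : Pos → Bool
    crossB p = isCross (Bᵇ (proj₁ p) (proj₂ p))

    crossT : Pos → Bool
    crossT p = isCross (Tᵇ (proj₁ p) (proj₂ p))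

    crossT-rotate : ∀ p → InBox n m p → crossT (rotate n m p) ≡ crossB p
    crossT-rotate (i , j) (i<n , j<m) =
      trans (cong isCross (Tᵇ-rotated _ _ (mirror-< i<n) (mirror-< j<m)))
            (trans (isCross-rot180 _) (cong₂ (λ x y → isCross (Bᵇ x y)) (mirror-involutive i<n) (mirror-involutive j<m)))

    -- Two pipes of T cross as often as their rotations, which are parts of two pipes of B.
    module PipePairOfT (a b : ℕ) (1≤a : 1 ≤ a) (a≤n : a ≤ n) (1≤b : 1 ≤ b) (b≤n : b ≤ n) (a≢b : a ≢ b)
                       (pos-a : 0 < α a) (pos-b : 0 < α b) where

      module A  = PipeOfT a 1≤a a≤n pos-a
      module B′ = PipeOfT b 1≤b b≤n pos-b

      on-pathB : ∀ {p} → counted crossB B′.inRegion p ≡ true → counted (isCrossAt B) (pathB B′.k) p ≡ true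
      on-pathB {i , j} counted≡ =
        ∧-intro (trans (isCrossAt-board B i j) (∧-conicalˡ _ _ counted≡))
                (∈⇒memberᵇ _ _ (subst ((i , j) ∈_) (sym B′.pathB≡)
                                  (++⁺ʳ B′.below (++⁺ˡ (memberᵇ⇒∈ (i , j) B′.inRegion (∧-conicalʳ _ _ counted≡))))))

      w≢ : w A.k ≢ w B′.k
      w≢ eq = a≢b (trans (sym (reverse-involutive a≤n))
                         (trans (cong (suc n ∸_) (injective A.k B′.k A.1≤k B′.1≤k eq)) (reverse-involutive b≤n)))

      cross-once : crossings T (pipeFromLeft T a) (pipeFromLeft T b) ≤ 1
      cross-once = begin
        crossings T (pipeFromLeft T a) (pipeFromLeft T b)
          ≡⟨ crossings≡crossCount T (pipeFromLeft T a) (pipeFromLeft T b) ⟩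
        crossCount (isCrossAt T) (proj₁ (pipeFromLeft T a)) (proj₁ (pipeFromLeft T b))
          ≡⟨ cong₂ (crossCount (isCrossAt T)) (cong proj₁ A.pipeFromLeft-T) (cong proj₁ B′.pipeFromLeft-T) ⟩
        crossCount (isCrossAt T) A.pathT B′.pathT
          ≡⟨ crossCount-cong _ _ A.pathT B′.pathT (λ p → isCrossAt-board T (proj₁ p) (proj₂ p)) ⟩
        crossCount crossT A.pathT B′.pathT
          ≡⟨ crossCount-reverse-map crossB crossT crossT-rotate A.inRegion B′.inRegion A.inRegion-inside B′.inRegion-inside ⟩
        crossCount crossB A.inRegion B′.inRegion
          ≤⟨ crossCount-mono _ _ A.inRegion _ _ (All.tabulate λ _ → on-pathB) ⟩
        crossCount (isCrossAt B) A.inRegion (pathB B′.k)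
          ≤⟨ subst (crossCount (isCrossAt B) A.inRegion (pathB B′.k) ≤_)
                   (cong (λ ps → crossCount (isCrossAt B) ps (pathB B′.k)) (sym A.pathB≡))
                   (crossCount-infix (isCrossAt B) A.below A.inRegion _ (pathB B′.k)) ⟩
        crossCount (isCrossAt B) (pathB A.k) (pathB B′.k)
          ≡⟨ sym (crossings≡crossCount B (pipeFromBottom B (w A.k)) (pipeFromBottom B (w B′.k))) ⟩
        crossings B (pipeFromBottom B (w A.k)) (pipeFromBottom B (w B′.k))
          ≤⟨ IsBPD.reduced bpd (w A.k) (w B′.k) (positive A.k A.1≤k) (w≤N A.k A.1≤k A.k≤N)
                               (positive B′.k B′.1≤k) (w≤N B′.k B′.1≤k B′.k≤N) w≢ ⟩
        1 ∎
        where
        open ≤-Reasoning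
        open CrossCountMap (InBox n m) (rotate n m) (rotate-injective n m)

    Tᵇ-horizontal : ∀ i j → i < n → suc j < m → rightE (Tᵇ i j) ≡ leftE (Tᵇ i (suc j))
    Tᵇ-horizontal i j i<n j+1<m = begin
      rightE (Tᵇ i j)
        ≡⟨ cong rightE (Tᵇ-rotated i j i<n j<m) ⟩
      rightE (rot180 (Bᵇ (n ∸ suc i) (m ∸ suc j)))
        ≡⟨ rightE-rot180 _ ⟩
      leftE (Bᵇ (n ∸ suc i) (m ∸ suc j))
        ≡⟨ cong (λ x → leftE (Bᵇ (n ∸ suc i) x)) (m∸n≡suc[m∸1+n] j+1<m) ⟩
      leftE (Bᵇ (n ∸ suc i) (suc (m ∸ suc (suc j))))
        ≡⟨ sym (Bᵇ-horizontal _ _ (≤-trans (mirror-< i<n) n≤N)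
           (≤-trans (subst (_< m) (m∸n≡suc[m∸1+n] j+1<m) (mirror-< j<m)) m≤N)) ⟩
      rightE (Bᵇ (n ∸ suc i) (m ∸ suc (suc j)))
        ≡⟨ sym (leftE-rot180 _) ⟩
      leftE (rot180 (Bᵇ (n ∸ suc i) (m ∸ suc (suc j))))
        ≡⟨ cong leftE (sym (Tᵇ-rotated i (suc j) i<n j+1<m)) ⟩
      leftE (Tᵇ i (suc j)) ∎
      where
      open ≡-Reasoning
      j<m : j < m
      j<m = <-trans (n<1+n j) j+1<m

    Tᵇ-vertical : ∀ i j → suc i < n → j < m → bottomE (Tᵇ i j) ≡ topE (Tᵇ (suc i) j)
    Tᵇ-vertical i j i+1<n j<m = begin
      bottomE (Tᵇ i j)
        ≡⟨ cong bottomE (Tᵇ-rotated i j i<n j<m) ⟩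
      bottomE (rot180 (Bᵇ (n ∸ suc i) (m ∸ suc j)))
        ≡⟨ bottomE-rot180 _ ⟩
      topE (Bᵇ (n ∸ suc i) (m ∸ suc j))
        ≡⟨ cong (λ x → topE (Bᵇ x (m ∸ suc j))) (m∸n≡suc[m∸1+n] i+1<n) ⟩
      topE (Bᵇ (suc (n ∸ suc (suc i))) (m ∸ suc j))
        ≡⟨ sym (Bᵇ-vertical _ _ (≤-trans (subst (_< n) (m∸n≡suc[m∸1+n] i+1<n) (mirror-< i<n)) n≤N)
           (≤-trans (mirror-< j<m) m≤N)) ⟩
      bottomE (Bᵇ (n ∸ suc (suc i)) (m ∸ suc j))
        ≡⟨ sym (topE-rot180 _) ⟩
      topE (rot180 (Bᵇ (n ∸ suc (suc i)) (m ∸ suc j)))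
        ≡⟨ cong topE (sym (Tᵇ-rotated (suc i) j i+1<n j<m)) ⟩
      topE (Tᵇ (suc i) j) ∎
      where
      open ≡-Reasoning
      i<n : i < n
      i<n = <-trans (n<1+n i) i+1<n

    right-of-region : ∀ i → i < N → 0 < m → rightE (Bᵇ i (m ∸ 1)) ≡ (w (suc i) <ᵇ suc m)
    right-of-region i i<N 0<m with m <? N
    ... | yes m<N = trans (Bᵇ-horizontal i (m ∸ 1) i<N (subst (_< N) (sym (suc[n∸1]≡n 0<m)) m<N))
                          (trans (cong (λ x → leftE (Bᵇ i x)) (suc[n∸1]≡n 0<m))
                                 (trans (cong leftE (rothe-outside i m i<N m<N (inj₂ ≤-refl))) (leftE-rothe (suc i) (suc m) (s≤s z≤n))))
    ... | no m≮N = trans (cong (λ x → rightE (Bᵇ i (x ∸ 1))) m≡N)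
                         (trans (Bᵇ-right i i<N) (sym (<ᵇ-true (s≤s (subst (w (suc i) ≤_) (sym m≡N) (w≤N (suc i) (s≤s z≤n) i<N))))))
      where
      m≡N : m ≡ N
      m≡N = ≤-antisym m≤N (≮⇒≥ m≮N)

    top-of-region : ∀ j → j < m → vertical (suc n) (suc (m ∸ suc j)) ≡ true → Σ ℕ λ k → 1 ≤ k × k ≤ n × α k ≡ suc j
    top-of-region j j<m v with i , 1≤i , s≤s i≤n , wi≡ ← vertical-sound (suc n) (suc (m ∸ suc j)) v
      with reverse-index i 1≤i i≤n | α (suc n ∸ i) ≟ 0
    ... | _ | yes α≡0 = ⊥-elim (<⇒≱ (pad⇒large i 1≤i i≤n α≡0) (subst (_≤ m) (sym wi≡) (mirror-< j<m)))
    ... | 1≤a , a≤n | no α≢0 = suc n ∸ i , 1≤a , a≤n , (begin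
      α (suc n ∸ i)
        ≡⟨ sym (suc[n∸1]≡n pos) ⟩
      suc (α (suc n ∸ i) ∸ 1)
        ≡⟨ cong suc (∸-flip pos (α≤m _ 1≤a a≤n) (trans (sym wi≡) (w-head-positive i 1≤i i≤n pos))) ⟩
      suc (m ∸ suc (m ∸ suc j))
        ≡⟨ cong suc (mirror-involutive j<m) ⟩
      suc j ∎)
      where
      open ≡-Reasoning
      pos : 0 < α (suc n ∸ i)
      pos = n≢0⇒n>0 α≢0

    T-left : ∀ (a : Fin n) (b : Fin m) → toℕ b ≡ 0 → leftE (T a b) ≡ (0 <ᵇ α (suc (toℕ a)))
    T-left a b b≡0 = begin
      leftE (T a b)
        ≡⟨ cong leftE (T-rotated a b) ⟩
      leftE (rot180 (Bᵇ i′ (m ∸ suc (toℕ b))))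
        ≡⟨ leftE-rot180 _ ⟩
      rightE (Bᵇ i′ (m ∸ suc (toℕ b)))
        ≡⟨ cong (λ x → rightE (Bᵇ i′ (m ∸ suc x))) b≡0 ⟩
      rightE (Bᵇ i′ (m ∸ 1))
        ≡⟨ right-of-region i′ (≤-trans (mirror-< (toℕ<n a)) n≤N) (≤-<-trans z≤n (toℕ<n b)) ⟩
      (w (suc i′) <ᵇ suc m)
        ≡⟨ sym (α-positive≡w-small i′ (mirror-< (toℕ<n a))) ⟩
      (0 <ᵇ α (n ∸ i′))
        ≡⟨ cong (λ x → 0 <ᵇ α x) (m∸[m∸n]≡n (toℕ<n a)) ⟩
      (0 <ᵇ α (suc (toℕ a))) ∎
      where
      open ≡-Reasoning
      i′ : ℕ
      i′ = n ∸ suc (toℕ a)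

    T-top : ∀ (a : Fin n) (b : Fin m) → toℕ a ≡ 0 → topE (T a b) ≡ true →
            Σ ℕ λ k → 1 ≤ k × k ≤ n × α k ≡ suc (toℕ b)
    T-top a b a≡0 top≡ = top-of-region (toℕ b) (toℕ<n b) (begin
      vertical (suc n) (suc j′)
        ≡⟨ sym (bottom-of-region j′ (≤-trans (mirror-< (toℕ<n b)) m≤N)) ⟩
      bottomE (Bᵇ (n ∸ 1) j′)
        ≡⟨ cong (λ x → bottomE (Bᵇ (n ∸ suc x) j′)) (sym a≡0) ⟩
      bottomE (Bᵇ (n ∸ suc (toℕ a)) j′)
        ≡⟨ sym (topE-rot180 _) ⟩
      topE (rot180 (Bᵇ (n ∸ suc (toℕ a)) j′))
        ≡⟨ cong topE (sym (T-rotated a b)) ⟩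
      topE (T a b)
        ≡⟨ top≡ ⟩
      true ∎)
      where
      open ≡-Reasoning
      j′ : ℕ
      j′ = m ∸ suc (toℕ b)

    T-bottom : ∀ (a : Fin n) (b : Fin m) → suc (toℕ a) ≡ n → bottomE (T a b) ≡ false
    T-bottom a b a+1≡n = begin
      bottomE (T a b)
        ≡⟨ cong bottomE (T-rotated a b) ⟩
      bottomE (rot180 (Bᵇ (n ∸ suc (toℕ a)) j′))
        ≡⟨ bottomE-rot180 _ ⟩
      topE (Bᵇ (n ∸ suc (toℕ a)) j′)
        ≡⟨ cong (λ x → topE (Bᵇ (n ∸ x) j′)) a+1≡n ⟩
      topE (Bᵇ (n ∸ n) j′)
        ≡⟨ cong (λ x → topE (Bᵇ x j′)) (n∸n≡0 n) ⟩
      topE (Bᵇ 0 j′)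
        ≡⟨ Bᵇ-top j′ (≤-trans (mirror-< (toℕ<n b)) m≤N) ⟩
      false ∎
      where
      open ≡-Reasoning
      j′ : ℕ
      j′ = m ∸ suc (toℕ b)

    T-right : ∀ (a : Fin n) (b : Fin m) → suc (toℕ b) ≡ m → rightE (T a b) ≡ false
    T-right a b b+1≡m = begin
      rightE (T a b)
        ≡⟨ cong rightE (T-rotated a b) ⟩
      rightE (rot180 (Bᵇ i′ (m ∸ suc (toℕ b))))
        ≡⟨ rightE-rot180 _ ⟩
      leftE (Bᵇ i′ (m ∸ suc (toℕ b)))
        ≡⟨ cong (λ x → leftE (Bᵇ i′ (m ∸ x))) b+1≡m ⟩
      leftE (Bᵇ i′ (m ∸ m))
        ≡⟨ cong (λ x → leftE (Bᵇ i′ x)) (n∸n≡0 m) ⟩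
      leftE (Bᵇ i′ 0)
        ≡⟨ Bᵇ-left i′ (≤-trans (mirror-< (toℕ<n a)) n≤N) ⟩
      false ∎
      where
      open ≡-Reasoning
      i′ : ℕ
      i′ = n ∸ suc (toℕ a)

    isLTBPD : IsLTBPD α n m T
    isLTBPD = record
      { wellTiled    = wellTiled-from-board T Tᵇ-horizontal Tᵇ-vertical
      ; leftBoundary = T-left
      ; topBoundary  = T-top
      ; bottomEmpty  = T-bottom
      ; rightEmpty   = T-right
      ; pipes        = λ k 1≤k k≤n pos → cong proj₂ (PipeOfT.pipeFromLeft-T k 1≤k k≤n pos)
      ; reduced      = PipePairOfT.cross-once
      }

proposition5p4 : (α : ℕ → ℕ) (n : ℕ) → Snowy α → IsLeastSuppBound α n →
                 (w : ℕ → ℕ) → IsStd (maxTo α n) n α w →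
                 (N : ℕ) (n≤N : n ≤ N) (m≤N : maxTo α n ≤ N) →
                 (∀ j → N < j → w j ≡ j) →
                 (T : Grid n (maxTo α n)) →
                 IsLTBPD α n (maxTo α n) T
                   ⇔ Σ (Grid N N) (λ B → IsBPD N w B
                       × (∀ i j → T i j ≡ restrictRotate n≤N m≤N B i j))
proposition5p4 α n _ lsb w std N n≤N m≤N fix T = mk⇔ toBPD fromBPD
  where
  open Standardization α n lsb w std N n≤N m≤N fix

  toBPD : IsLTBPD α n m T → Σ (Grid N N) λ B → IsBPD N w B × (∀ i j → T i j ≡ restrictRotate n≤N m≤N B i j)
  toBPD ltbpd = B , isBPD , region-T
    where open FromLTBPD T ltbpd

  fromBPD : Σ (Grid N N) (λ B → IsBPD N w B × (∀ i j → T i j ≡ restrictRotate n≤N m≤N B i j)) → IsLTBPD α n m T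
  fromBPD (B , bpd , T≡) = ToLTBPD.isLTBPD B bpd T T≡
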